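{- For every integer $n\geq 4$, every subdivision of the complete graph $K_n$ has cliquewidth at most $n+2$.
   Context: Graphs are finite and simple. A subdivision of a graph $H$ is any graph obtained from $H$ by replacing each edge $uv$ with a path from $u$ to $v$ of length at least $1$ (internally disjoint new paths). With colourings $c:V(G)\to\{1,\dots,k\}$ (colour $i$ used if $c^{ -1}(i)\ne\emptyset$), $(G,c)$ is a cliquewidth-$k$ pair if $|V(G)|\leq 1$ or: (OP1) $G$ is the disjoint union of nonempty $G_1,G_2$ with $(G_1,c|_{V(G_1)}),(G_2,c|_{V(G_2)})$ cliquewidth-$k$ pairs; or (OP2) there are a colouring $c'$ and distinct $i,j$, both used by $c'$, with $(G,c')$ a cliquewidth-$k$ pair and $c$ obtained from $c'$ by recolouring every vertex of colour $i$ to $j$; or (OP3) there are a proper spanning subgraph $G'$ of $G$ and distinct $i,j$ with $(G',c)$ a cliquewidth-$k$ pair and $G$ obtained from $G'$ by adding all edges between vertices coloured $i$ and vertices coloured $j$. The cliquewidth of $G$ is the least $k$ such that $(G,c)$ is a cliquewidth-$k$ pair for some colouring $c$ with colours $\{1,\dots,k\}$. -}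

module Defs where

open import Data.Nat using (ℕ; zero; suc; _+_; _≤_)
open import Data.Fin using (Fin; zero; suc; toℕ; inject₁; _<_; splitAt; _↑ˡ_; _↑ʳ_)
open import Data.Bool using (Bool; true; false; _∨_; _∧_; if_then_else_)
open import Data.Sum using (_⊎_; inj₁; inj₂)
open import Data.Product using (Σ; ∃; ∃-syntax; _×_; _,_)
open import Relation.Binary.PropositionalEquality using (_≡_; _≢_)
open import Relation.Nullary using (¬_; does)
open import Function.Bundles using (_↔_; Inverse)
open import Function.Definitions using (Injective)
open import Data.Fin using (_≟_)

record Graph (m : ℕ) : Set where
  field
    adj   : Fin m → Fin m → Bool
    sym   : ∀ x y → adj x y ≡ adj y x
    irrefl : ∀ x → adj x x ≡ false
open Graph public

Used : ∀ {m k} → (Fin m → Fin k) → Fin k → Set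
Used c i = ∃[ x ] c x ≡ i

_==_ : ∀ {k} → Fin k → Fin k → Bool
i == j = does (i ≟ j)

-- Cliquewidth-k pairs (G , c), following (OP1)-(OP3); the colour set
-- is {1..k}, represented as Fin k.  Disjoint union is realised on the
-- vertex set Fin (a + b) = Fin a ⊎ Fin b, and the notion is closed
-- under renaming vertices along a bijection (the paper's notion is
-- about graphs whose vertex set is partitioned, i.e. is invariant
-- under isomorphism).

data CWPair (k : ℕ) : (m : ℕ) → Graph m → (Fin m → Fin k) → Set where
  small : ∀ {m} (G : Graph m) (c : Fin m → Fin k) → m ≤ 1 → CWPair k m G c
  iso   : ∀ {m} {G G' : Graph m} {c c' : Fin m → Fin k} (σ : Fin m ↔ Fin m) →
          CWPair k m G c →
          (∀ x y → adj G' x y ≡ adj G (Inverse.to σ x) (Inverse.to σ y)) →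
          (∀ x → c' x ≡ c (Inverse.to σ x)) →
          CWPair k m G' c'
  union : ∀ {a b} {G₁ : Graph a} {G₂ : Graph b} {c₁ c₂} {G : Graph (a + b)} {c : Fin (a + b) → Fin k} →
          1 ≤ a → 1 ≤ b →
          CWPair k a G₁ c₁ → CWPair k b G₂ c₂ →
          (∀ x y → adj G (x ↑ˡ b) (y ↑ˡ b) ≡ adj G₁ x y) →
          (∀ x y → adj G (a ↑ʳ x) (a ↑ʳ y) ≡ adj G₂ x y) →
          (∀ x y → adj G (x ↑ˡ b) (a ↑ʳ y) ≡ false) →
          (∀ x → c (x ↑ˡ b) ≡ c₁ x) →
          (∀ y → c (a ↑ʳ y) ≡ c₂ y) →
          CWPair k (a + b) G c
  recolour : ∀ {m} {G : Graph m} {c c' : Fin m → Fin k} (i j : Fin k) →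
          i ≢ j → Used c' i → Used c' j →
          CWPair k m G c' →
          (∀ x → c x ≡ (if c' x == i then j else c' x)) →
          CWPair k m G c
  join  : ∀ {m} {G G' : Graph m} {c : Fin m → Fin k} (i j : Fin k) →
          i ≢ j →
          CWPair k m G' c →
          (∀ x y → adj G' x y ≡ true → adj G x y ≡ true) →
          (∃[ x ] ∃[ y ] (adj G x y ≡ true × adj G' x y ≡ false)) →
          (∀ x y → adj G x y ≡
                     (adj G' x y ∨ ((c x == i) ∧ (c y == j)) ∨ ((c x == j) ∧ (c y == i)))) →
          CWPair k m G c

CliquewidthAtMost : ∀ {m} → Graph m → ℕ → Set
CliquewidthAtMost {m} G k = ∃[ k' ] (k' ≤ k × Σ (Fin m → Fin k') λ c → CWPair k' m G c)

-- Branch vertices  branch : Fin n → Fin m  (injective); for each pair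
-- i < j a path  path i j : Fin (suc (len i j)) → Fin m  of length
-- len i j ≥ 1 from branch i to branch j (data for i ≥ j is ignored).

Internal : ∀ {L} → Fin (suc L) → Set
Internal {L} t = 0 Data.Nat.< toℕ t × toℕ t Data.Nat.< L

infix 2 _⇔′_
_⇔′_ : Set → Set → Set
A ⇔′ B = (A → B) × (B → A)

record SubdivisionOfK (n : ℕ) {m : ℕ} (G : Graph m) : Set where
  field
    branch      : Fin n → Fin m
    branch-inj  : Injective _≡_ _≡_ branch
    len         : Fin n → Fin n → ℕ
    path        : (i j : Fin n) → Fin (suc (len i j)) → Fin m
    len-pos     : ∀ i j → i < j → 1 ≤ len i j
    path-start  : ∀ i j → i < j → path i j zero ≡ branch i
    path-end    : ∀ i j → i < j → path i j (Data.Fin.fromℕ (len i j)) ≡ branch j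
    path-inj    : ∀ i j → i < j → Injective _≡_ _≡_ (path i j)
    internal-new : ∀ i j → i < j → ∀ t → Internal t → ∀ l → path i j t ≢ branch l
    internal-disj : ∀ i j i' j' → i < j → i' < j' → ∀ s t → Internal s → Internal t →
                    path i j s ≡ path i' j' t → (i ≡ i' × j ≡ j')
    covers      : ∀ v → (∃[ l ] branch l ≡ v) ⊎
                        (∃[ i ] ∃[ j ] (i < j × Σ (Fin (suc (len i j))) λ t → Internal t × path i j t ≡ v))
    edges       : ∀ x y → (adj G x y ≡ true) ⇔′
                    (∃[ i ] ∃[ j ] (i < j × Σ (Fin (len i j)) λ t →
                       (path i j (inject₁ t) ≡ x × path i j (suc t) ≡ y) ⊎
                       (path i j (inject₁ t) ≡ y × path i j (suc t) ≡ x)))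

{-# OPTIONS --safe #-}
module Submission where

-- Build the subdivision one branch vertex at a time, using the colours 0, …, n + 1: branch
-- vertex l keeps colour l, an inner vertex whose neighbours are all present gets the dead colour
-- n, and n + 1 is the live colour of whatever is being attached.  Before branch vertex J arrives,
-- every path from an earlier branch vertex I to J is built on its own (first vertex live, last
-- vertex coloured J, the others dead; growing it takes two more colours, and 0 and 1 are free
-- inside the path), and its live end is joined to colour I.  Then J arrives live and is joined to
-- colour J, i.e. to the ends of those paths, and to each colour I for which I J is an edge.

open import Defs hiding (sym)
open import Data.Bool using (Bool; true; false; T; not; _∧_; _∨_; if_then_else_)
open import Data.Bool.Properties
  using (T-∧; T-∨; T-≡; T-not-≡; if-float; ∨-assoc; ∨-comm; ∧-comm; ∨-identityʳ; ∧-identityʳ; ∧-zeroʳ)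
open import Data.Empty using (⊥-elim)
open import Data.Fin as Fin using (Fin; zero; suc; toℕ; fromℕ<; _↑ˡ_; _↑ʳ_; splitAt)
open import Data.Fin.Properties
  using ( toℕ-injective; toℕ-fromℕ<; toℕ-fromℕ; toℕ-inject₁; toℕ<n; splitAt-↑ˡ; splitAt-↑ʳ; join-splitAt
        ; nonZeroIndex; any?; cantor-schröder-bernstein)
import Data.Fin.Permutation.Components as Perm
open import Data.Nat using (ℕ; zero; suc; _+_; _≤_; _<_; z≤n; s≤s; _≡ᵇ_; _<ᵇ_; >-nonZero⁻¹; NonZero)
open import Data.Nat.DivMod using (_mod_; m<n⇒m%n≡m)
import Data.Nat.Properties as ℕₚ
open ℕₚ using (_<?_; _≤?_; ≡ᵇ⇒≡; ≡⇒≡ᵇ) renaming (_≟_ to _≟ℕ_)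
open import Data.Product using (∃-syntax; _×_; _,_; proj₁; proj₂)
open import Data.Sum as Sum using (_⊎_; inj₁; inj₂; [_,_])
open import Function using (id; _∘_; mk⇔; Equivalence)
open import Function.Bundles using (mk↔ₛ′)
open import Function.Construct.Identity using (↔-id)
open import Function.Definitions using (Injective)
open import Relation.Binary.Definitions using (DecidableEquality)
open import Relation.Binary.PropositionalEquality hiding ([_])
open import Relation.Nullary using (¬_; Dec; yes; no; does; T?; _×-dec_; _⊎-dec_)
open import Relation.Nullary.Decidable using (dec-true; dec-false; does-⇔; map′; ⌊_⌋; fromWitness; toWitness)

T-ext : ∀ {a b} → (T a → T b) → (T b → T a) → a ≡ b
T-ext {false} {false} _   _   = refl
T-ext {false} {true}  _   b⇒a = ⊥-elim (b⇒a _)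
T-ext {true}  {false} a⇒b _   = ⊥-elim (a⇒b _)
T-ext {true}  {true}  _   _   = refl

¬T⇒≡false : ∀ {b} → ¬ T b → b ≡ false
¬T⇒≡false {false} _  = refl
¬T⇒≡false {true}  ¬t = ⊥-elim (¬t _)

≡ᵇ-true : ∀ {m n} → m ≡ n → (m ≡ᵇ n) ≡ true
≡ᵇ-true {m} {n} = dec-true (m ≟ℕ n)

≡ᵇ-false : ∀ {m n} → m ≢ n → (m ≡ᵇ n) ≡ false
≡ᵇ-false {m} {n} = dec-false (m ≟ℕ n)

<ᵇ-true : ∀ {m n} → m < n → (m <ᵇ n) ≡ true
<ᵇ-true {m} {n} = dec-true (m <? n)

<ᵇ-false : ∀ {m n} → n ≤ m → (m <ᵇ n) ≡ false
<ᵇ-false {m} {n} n≤m = dec-false (m <? n) (ℕₚ.≤⇒≯ n≤m)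

-- Closure properties of cliquewidth pairs

==-toℕ : ∀ {k} (a b : Fin k) → (a == b) ≡ (toℕ a ≡ᵇ toℕ b)
==-toℕ a b = does-⇔ (mk⇔ (cong toℕ) toℕ-injective) (a Fin.≟ b) (toℕ a ≟ℕ toℕ b)

==-injective : ∀ {k} {π : Fin k → Fin k} → Injective _≡_ _≡_ π → ∀ a b → (π a == π b) ≡ (a == b)
==-injective {π = π} π-inj a b = does-⇔ (mk⇔ π-inj (cong π)) (π a Fin.≟ π b) (a Fin.≟ b)

CWPair-cong : ∀ {k m} {G G′ : Graph m} {c c′ : Fin m → Fin k} → CWPair k m G c →
              (∀ x y → adj G′ x y ≡ adj G x y) → (∀ x → c′ x ≡ c x) → CWPair k m G′ c′
CWPair-cong = iso (↔-id _)

relabel : ∀ {k m} {G : Graph m} {c : Fin m → Fin k} (π : Fin k → Fin k) → Injective _≡_ _≡_ π →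
          CWPair k m G c → CWPair k m G (π ∘ c)
relabel π π-inj (small G c m≤1) = small G (π ∘ c) m≤1
relabel π π-inj (iso σ p adj≡ c≡) = iso σ (relabel π π-inj p) adj≡ (cong π ∘ c≡)
relabel π π-inj (union 1≤a 1≤b p q adjˡ adjʳ adjˡʳ cˡ cʳ) =
  union 1≤a 1≤b (relabel π π-inj p) (relabel π π-inj q) adjˡ adjʳ adjˡʳ (cong π ∘ cˡ) (cong π ∘ cʳ)
relabel π π-inj (recolour {c' = c′} i j i≢j (x , cx≡i) (y , cy≡j) p c≡) =
  recolour (π i) (π j) (i≢j ∘ π-inj) (x , cong π cx≡i) (y , cong π cy≡j) (relabel π π-inj p) λ z →
    trans (cong π (c≡ z)) (trans (if-float π (c′ z == i))
      (cong (if_then π j else π (c′ z)) (sym (==-injective π-inj (c′ z) i))))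
relabel π π-inj (join {G' = G′} {c = c} i j i≢j p sub new adj≡) =
  join (π i) (π j) (i≢j ∘ π-inj) (relabel π π-inj p) sub new λ x y →
    trans (adj≡ x y) (sym (cong₂ (λ e f → adj G′ x y ∨ e ∨ f)
      (cong₂ _∧_ (==-injective π-inj (c x) i) (==-injective π-inj (c y) j))
      (cong₂ _∧_ (==-injective π-inj (c x) j) (==-injective π-inj (c y) i))))

join′ : ∀ {k m} {G G′ : Graph m} {c : Fin m → Fin k} (i j : Fin k) → i ≢ j → CWPair k m G′ c →
        (∀ x y → adj G x y ≡ (adj G′ x y ∨ ((c x == i) ∧ (c y == j)) ∨ ((c x == j) ∧ (c y == i)))) →
        CWPair k m G c
join′ {G = G} {G′} i j i≢j p adj≡ with any? (λ x → any? (λ y → T? (adj G x y ∧ not (adj G′ x y))))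
... | yes (x , y , new) =
  join i j i≢j p sub (x , y , Equivalence.to T-≡ (proj₁ new′) , Equivalence.to T-not-≡ (proj₂ new′)) adj≡
  where
    new′ : T (adj G x y) × T (not (adj G′ x y))
    new′ = Equivalence.to T-∧ new
    sub : ∀ x y → adj G′ x y ≡ true → adj G x y ≡ true
    sub x y e = trans (adj≡ x y) (cong (_∨ _) e)
... | no none = CWPair-cong p (λ x y → no-new (adj≡ x y) (none ∘ λ new → x , y , new)) (λ _ → refl)
  where
    no-new : ∀ {a b c} → a ≡ (b ∨ c) → ¬ T (a ∧ not b) → a ≡ b
    no-new {b = true}  refl _   = refl
    no-new {false} {false} _ _   = refl
    no-new {true}  {false} _ new = ⊥-elim (new _)

recolour-self : ∀ {k} (a b : Fin k) → (if a == b then b else a) ≡ a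
recolour-self a b with a Fin.≟ b
... | yes refl = refl
... | no _     = refl

recolour-transpose : ∀ {k} (i j a : Fin k) → a ≢ j → (if a == i then j else a) ≡ Perm.transpose i j a
recolour-transpose i j a a≢j with does (a Fin.≟ i)
... | true  = refl
... | false rewrite dec-false (a Fin.≟ j) a≢j = refl

transpose-injective : ∀ {k} (i j : Fin k) → Injective _≡_ _≡_ (Perm.transpose i j)
transpose-injective i j {a} {b} e =
  trans (sym (Perm.transpose-inverse j i)) (trans (cong (Perm.transpose j i) e) (Perm.transpose-inverse j i))

-- OP2 without its side conditions: recolouring i to itself or an unused i changes nothing, and
-- recolouring i into an unused j is the transposition of i and j.
recolour′ : ∀ {k m} {G : Graph m} {c c′ : Fin m → Fin k} (i j : Fin k) → CWPair k m G c′ →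
            (∀ x → c x ≡ (if c′ x == i then j else c′ x)) → CWPair k m G c
recolour′ {c′ = c′} i j p c≡ with i Fin.≟ j | any? (λ x → c′ x Fin.≟ i) | any? (λ x → c′ x Fin.≟ j)
... | yes refl | _ | _ = CWPair-cong p (λ _ _ → refl) (λ x → trans (c≡ x) (recolour-self (c′ x) i))
... | no _ | no unusedᵢ | _ = CWPair-cong p (λ _ _ → refl) λ x →
  trans (c≡ x) (cong (if_then j else c′ x) (dec-false (c′ x Fin.≟ i) (unusedᵢ ∘ (x ,_))))
... | no i≢j | yes usedᵢ | yes usedⱼ = recolour i j i≢j usedᵢ usedⱼ p c≡
... | no _ | yes _ | no unusedⱼ =
  CWPair-cong (relabel (Perm.transpose i j) (transpose-injective i j) p) (λ _ _ → refl) λ x →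
    trans (c≡ x) (recolour-transpose i j (c′ x) (unusedⱼ ∘ (x ,_)))

CWPair-transport : ∀ {k s m} {H : Graph s} {G : Graph m} {c : Fin s → Fin k}
                   (f : Fin s → Fin m) (g : Fin m → Fin s) → (∀ y → f (g y) ≡ y) → (∀ x → g (f x) ≡ x) →
                   CWPair k s H c → (∀ y y′ → adj G y y′ ≡ adj H (g y) (g y′)) → CWPair k m G (c ∘ g)
CWPair-transport f g fg gf p adj≡
  with cantor-schröder-bernstein (inverse⇒injective {h⁻¹ = g} gf) (inverse⇒injective {h⁻¹ = f} fg)
  where
    inverse⇒injective : ∀ {a b} {h : Fin a → Fin b} {h⁻¹ : Fin b → Fin a} →
                        (∀ x → h⁻¹ (h x) ≡ x) → Injective _≡_ _≡_ h
    inverse⇒injective {h⁻¹ = h⁻¹} inv {x} {y} e = trans (sym (inv x)) (trans (cong h⁻¹ e) (inv y))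
... | refl = iso (mk↔ₛ′ g f gf fg) p adj≡ (λ _ → refl)

-- Graphs on an arbitrary vertex type and their expressible subsets

record GraphOn (V : Set) : Set where
  field
    E        : V → V → Bool
    E-sym    : ∀ u v → E u v ≡ E v u
    E-irrefl : ∀ v → E v v ≡ false
open GraphOn public

pullback : ∀ {V s} → GraphOn V → (Fin s → V) → Graph s
pullback G f = record
  { adj = λ x y → E G (f x) (f y) ; sym = λ x y → E-sym G (f x) (f y) ; irrefl = E-irrefl G ∘ f }

Subset : Set → Set
Subset V = V → Bool

module _ {V : Set} where
  infix 4 _∈_ _⊆_

  record _∈_ (v : V) (S : Subset V) : Set where
    constructor member
    field holds : T (S v)
  open _∈_ public

  _⊆_ : Subset V → Subset V → Set
  S ⊆ S′ = ∀ {v} → v ∈ S → v ∈ S′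

  _∪_ : Subset V → Subset V → Subset V
  (S₁ ∪ S₂) v = S₁ v ∨ S₂ v

  Disjoint : Subset V → Subset V → Set
  Disjoint S₁ S₂ = ∀ {v} → v ∈ S₁ → ¬ v ∈ S₂

  ∈-∪ˡ : ∀ {S₁ S₂ v} → v ∈ S₁ → v ∈ S₁ ∪ S₂
  ∈-∪ˡ (member h) = member (Equivalence.from T-∨ (inj₁ h))

  ∈-∪ʳ : ∀ {S₁ S₂ v} → v ∈ S₂ → v ∈ S₁ ∪ S₂
  ∈-∪ʳ {S₁} {v = v} (member h) = member (Equivalence.from (T-∨ {S₁ v}) (inj₂ h))

  ∈-∪⁻ : ∀ {S₁ S₂ v} → v ∈ S₁ ∪ S₂ → v ∈ S₁ ⊎ v ∈ S₂
  ∈-∪⁻ {S₁} {v = v} (member h) = Sum.map member member (Equivalence.to (T-∨ {S₁ v}) h)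

  ∈⇒≡true : ∀ {S v} → v ∈ S → S v ≡ true
  ∈⇒≡true = Equivalence.to T-≡ ∘ holds

  ∉⇒≡false : ∀ {S v} → ¬ v ∈ S → S v ≡ false
  ∉⇒≡false v∉S = ¬T⇒≡false (v∉S ∘ member)

  infixl 9 _[_↦_]

  _[_↦_] : (V → ℕ) → ℕ → ℕ → V → ℕ
  (c [ i ↦ j ]) v = if c v ≡ᵇ i then j else c v

  joined : (V → ℕ) → ℕ → ℕ → V → V → Bool
  joined c i j u v = ((c u ≡ᵇ i) ∧ (c v ≡ᵇ j)) ∨ ((c u ≡ᵇ j) ∧ (c v ≡ᵇ i))

  joined-sym : ∀ (c : V → ℕ) i j u v → joined c i j u v ≡ joined c i j v u
  joined-sym c i j u v =
    trans (cong₂ _∨_ (∧-comm (c u ≡ᵇ i) _) (∧-comm (c u ≡ᵇ j) _)) (∨-comm ((c v ≡ᵇ j) ∧ (c u ≡ᵇ i)) _)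

  joined⇒ : ∀ {c : V → ℕ} {i j u v} → T (joined c i j u v) → (c u ≡ i × c v ≡ j) ⊎ (c u ≡ j × c v ≡ i)
  joined⇒ {c} {i} {j} {u} {v} t =
    Sum.map (both ∘ Equivalence.to T-∧) (both ∘ Equivalence.to T-∧)
            (Equivalence.to (T-∨ {(c u ≡ᵇ i) ∧ (c v ≡ᵇ j)}) t)
    where
      both : ∀ {a b a′ b′} → T (a ≡ᵇ a′) × T (b ≡ᵇ b′) → a ≡ a′ × b ≡ b′
      both {a} {b} {a′} {b′} (p , q) = ≡ᵇ⇒≡ a a′ p , ≡ᵇ⇒≡ b b′ q

  joined⇐ : ∀ {c : V → ℕ} {i j u v} → c u ≡ j → c v ≡ i → T (joined c i j u v)
  joined⇐ {c} {i} {j} {u} {v} refl refl =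
    Equivalence.from (T-∨ {(c u ≡ᵇ i) ∧ (c v ≡ᵇ c u)})
      (inj₂ (Equivalence.from T-∧ (≡⇒≡ᵇ (c u) (c u) refl , ≡⇒≡ᵇ (c v) i refl)))

record Expressible {V : Set} (k : ℕ) (G : GraphOn V) (S : Subset V) (c : V → ℕ) : Set where
  field
    size             : ℕ
    vertex           : Fin size → V
    vertex-injective : Injective _≡_ _≡_ vertex
    vertex-∈         : ∀ x → vertex x ∈ S
    vertex-onto      : ∀ {v} → v ∈ S → ∃[ x ] vertex x ≡ v
    colour           : Fin size → Fin k
    colour-toℕ       : ∀ x → toℕ (colour x) ≡ c (vertex x)
    pair             : CWPair k size (pullback G vertex) colour

  colour-== : ∀ x {i} (i<k : i < k) → (colour x == fromℕ< i<k) ≡ (c (vertex x) ≡ᵇ i)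
  colour-== x i<k = trans (==-toℕ (colour x) (fromℕ< i<k)) (cong₂ _≡ᵇ_ (colour-toℕ x) (toℕ-fromℕ< i<k))

  colour-< : ∀ {v} → v ∈ S → c v < k
  colour-< v∈S with vertex-onto v∈S
  ... | x , refl = subst (_< k) (colour-toℕ x) (toℕ<n (colour x))

module DisjointUnion {V : Set} {k : ℕ} {G : GraphOn V} {S₁ S₂ : Subset V} {c : V → ℕ}
                     (X : Expressible k G S₁ c) (Y : Expressible k G S₂ c) (disjoint : Disjoint S₁ S₂) where
  private
    module X = Expressible X
    module Y = Expressible Y
    a b : ℕ
    a = X.size
    b = Y.size

  vertex : Fin (a + b) → V
  vertex = [ X.vertex , Y.vertex ] ∘ splitAt a

  colour : Fin (a + b) → Fin k
  colour = [ X.colour , Y.colour ] ∘ splitAt a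

  vertexˡ : ∀ x → vertex (x ↑ˡ b) ≡ X.vertex x
  vertexˡ x = cong [ X.vertex , Y.vertex ] (splitAt-↑ˡ a x b)

  vertexʳ : ∀ y → vertex (a ↑ʳ y) ≡ Y.vertex y
  vertexʳ y = cong [ X.vertex , Y.vertex ] (splitAt-↑ʳ a b y)

  vertex-injective : Injective _≡_ _≡_ vertex
  vertex-injective {x} {y} e =
    trans (sym (join-splitAt a b x))
          (trans (cong (Fin.join a b) (sum-injective (splitAt a x) (splitAt a y) e)) (join-splitAt a b y))
    where
      sum-injective : ∀ p q → [ X.vertex , Y.vertex ] p ≡ [ X.vertex , Y.vertex ] q → p ≡ q
      sum-injective (inj₁ p) (inj₁ q) e = cong inj₁ (X.vertex-injective e)
      sum-injective (inj₂ p) (inj₂ q) e = cong inj₂ (Y.vertex-injective e)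
      sum-injective (inj₁ p) (inj₂ q) e = ⊥-elim (disjoint (X.vertex-∈ p) (subst (_∈ S₂) (sym e) (Y.vertex-∈ q)))
      sum-injective (inj₂ p) (inj₁ q) e = ⊥-elim (disjoint (X.vertex-∈ q) (subst (_∈ S₂) e (Y.vertex-∈ p)))

  vertex-∈ : ∀ x → vertex x ∈ S₁ ∪ S₂
  vertex-∈ x with splitAt a x
  ... | inj₁ x₁ = ∈-∪ˡ (X.vertex-∈ x₁)
  ... | inj₂ x₂ = ∈-∪ʳ {S₁ = S₁} (Y.vertex-∈ x₂)

  vertex-onto : ∀ {v} → v ∈ S₁ ∪ S₂ → ∃[ x ] vertex x ≡ v
  vertex-onto v∈S with ∈-∪⁻ {S₁ = S₁} v∈S
  ... | inj₁ v∈S₁ = let x , e = X.vertex-onto v∈S₁ in x ↑ˡ b , trans (vertexˡ x) e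
  ... | inj₂ v∈S₂ = let y , e = Y.vertex-onto v∈S₂ in a ↑ʳ y , trans (vertexʳ y) e

  colour-toℕ : ∀ x → toℕ (colour x) ≡ c (vertex x)
  colour-toℕ x with splitAt a x
  ... | inj₁ x₁ = X.colour-toℕ x₁
  ... | inj₂ x₂ = Y.colour-toℕ x₂

module _ {V : Set} {k : ℕ} where

  Expressible-cong : ∀ {G G′ : GraphOn V} {S S′ c c′} → Expressible k G S c → S ⊆ S′ → S′ ⊆ S →
                     (∀ {u v} → u ∈ S → v ∈ S → E G′ u v ≡ E G u v) → (∀ {v} → v ∈ S → c′ v ≡ c v) →
                     Expressible k G′ S′ c′
  Expressible-cong X S⊆S′ S′⊆S E≡ c≡ = record
    { size = size ; vertex = vertex ; vertex-injective = vertex-injective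
    ; vertex-∈ = S⊆S′ ∘ vertex-∈ ; vertex-onto = vertex-onto ∘ S′⊆S
    ; colour = colour ; colour-toℕ = λ x → trans (colour-toℕ x) (sym (c≡ (vertex-∈ x)))
    ; pair = CWPair-cong pair (λ x y → E≡ (vertex-∈ x) (vertex-∈ y)) (λ _ → refl) }
    where open Expressible X

  Expressible-singleton : ∀ {G : GraphOn V} {S c} v → v ∈ S → (∀ {u} → u ∈ S → u ≡ v) → c v < k →
                          Expressible k G S c
  Expressible-singleton v v∈S only cv<k = record
    { size = 1 ; vertex = λ _ → v ; vertex-injective = λ { {zero} {zero} _ → refl }
    ; vertex-∈ = λ _ → v∈S ; vertex-onto = λ u∈S → zero , sym (only u∈S)
    ; colour = λ _ → fromℕ< cv<k ; colour-toℕ = λ _ → toℕ-fromℕ< cv<k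
    ; pair = small _ _ (s≤s z≤n) }

  Expressible-union : ∀ {G : GraphOn V} {S₁ S₂ c} → Expressible k G S₁ c → Expressible k G S₂ c →
                      ∃[ v₁ ] v₁ ∈ S₁ → ∃[ v₂ ] v₂ ∈ S₂ → Disjoint S₁ S₂ →
                      (∀ {u v} → u ∈ S₁ → v ∈ S₂ → E G u v ≡ false) → Expressible k G (S₁ ∪ S₂) c
  Expressible-union {G} X Y (_ , v₁∈S₁) (_ , v₂∈S₂) disjoint no-edge = record
    { size = _ ; vertex = vertex ; vertex-injective = vertex-injective ; vertex-∈ = vertex-∈
    ; vertex-onto = vertex-onto ; colour = colour ; colour-toℕ = colour-toℕ
    ; pair = union (nonEmpty X v₁∈S₁) (nonEmpty Y v₂∈S₂) (Expressible.pair X) (Expressible.pair Y)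
               (λ x y → cong₂ (E G) (vertexˡ x) (vertexˡ y)) (λ x y → cong₂ (E G) (vertexʳ x) (vertexʳ y))
               (λ x y → trans (cong₂ (E G) (vertexˡ x) (vertexʳ y))
                              (no-edge (Expressible.vertex-∈ X x) (Expressible.vertex-∈ Y y)))
               (λ x → cong [ Expressible.colour X , Expressible.colour Y ] (splitAt-↑ˡ _ x _))
               (λ y → cong [ Expressible.colour X , Expressible.colour Y ] (splitAt-↑ʳ _ _ y)) }
    where
      open DisjointUnion X Y disjoint
      nonEmpty : ∀ {S c v} (Z : Expressible k G S c) → v ∈ S → 1 ≤ Expressible.size Z
      nonEmpty Z v∈S = >-nonZero⁻¹ _ {{nonZeroIndex (proj₁ (Expressible.vertex-onto Z v∈S))}}

  Expressible-join : ∀ {G G′ : GraphOn V} {S c i j} → i < k → j < k → i ≢ j → Expressible k G′ S c →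
                     (∀ {u v} → u ∈ S → v ∈ S → E G u v ≡ (E G′ u v ∨ joined c i j u v)) →
                     Expressible k G S c
  Expressible-join {G′ = G′} {i = i} {j} i<k j<k i≢j X E≡ = record
    { size = size ; vertex = vertex ; vertex-injective = vertex-injective
    ; vertex-∈ = vertex-∈ ; vertex-onto = vertex-onto ; colour = colour ; colour-toℕ = colour-toℕ
    ; pair = join′ (fromℕ< i<k) (fromℕ< j<k) (i≢j ∘ fromℕ<-injective) pair λ x y →
        trans (E≡ (vertex-∈ x) (vertex-∈ y)) (cong (E G′ (vertex x) (vertex y) ∨_) (sym
          (cong₂ _∨_ (cong₂ _∧_ (colour-== x i<k) (colour-== y j<k))
                     (cong₂ _∧_ (colour-== x j<k) (colour-== y i<k))))) }
    where
      open Expressible X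
      fromℕ<-injective : fromℕ< i<k ≡ fromℕ< j<k → i ≡ j
      fromℕ<-injective e = trans (sym (toℕ-fromℕ< i<k)) (trans (cong toℕ e) (toℕ-fromℕ< j<k))

  Expressible-recolour : ∀ {G : GraphOn V} {S c i j} → i < k → j < k → Expressible k G S c →
                         Expressible k G S (c [ i ↦ j ])
  Expressible-recolour {c = c} {i} {j} i<k j<k X = record
    { size = size ; vertex = vertex ; vertex-injective = vertex-injective
    ; vertex-∈ = vertex-∈ ; vertex-onto = vertex-onto ; colour = colour′ ; colour-toℕ = colour′-toℕ
    ; pair = recolour′ (fromℕ< i<k) (fromℕ< j<k) pair (λ _ → refl) }
    where
      open Expressible X
      colour′ : Fin size → Fin k
      colour′ x = if colour x == fromℕ< i<k then fromℕ< j<k else colour x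
      colour′-toℕ : ∀ x → toℕ (colour′ x) ≡ (c [ i ↦ j ]) (vertex x)
      colour′-toℕ x = begin
        toℕ (colour′ x)
          ≡⟨ if-float toℕ (colour x == fromℕ< i<k) ⟩
        (if colour x == fromℕ< i<k then toℕ (fromℕ< j<k) else toℕ (colour x))
          ≡⟨ cong₂ (if_then_else_ _) (toℕ-fromℕ< j<k) (colour-toℕ x) ⟩
        (if colour x == fromℕ< i<k then j else c (vertex x))
          ≡⟨ cong (if_then j else c (vertex x)) (colour-== x i<k) ⟩
        (if c (vertex x) ≡ᵇ i then j else c (vertex x))
          ∎
        where open ≡-Reasoning

-- Take the disjoint union in G without its S₁–S₂ edges, then join i with each colour x < k in C.
-- Colour i occurs only in S₂ and the colours in C only in S₁, so these joins add exactly the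
-- S₁–S₂ edges of G.
module Attach {V : Set} {k : ℕ} {G : GraphOn V} {S₁ S₂ : Subset V} {c : V → ℕ} (i : ℕ) (C : ℕ → Bool)
              (i<k : i < k) (i∉C : C i ≡ false) (disjoint : Disjoint S₁ S₂)
              (S₁≢i : ∀ {u} → u ∈ S₁ → c u ≢ i) (S₁<k : ∀ {u} → u ∈ S₁ → c u < k)
              (S₂∉C : ∀ {v} → v ∈ S₂ → C (c v) ≡ false)
              (across : ∀ {u v} → u ∈ S₁ → v ∈ S₂ → E G u v ≡ (C (c u) ∧ (c v ≡ᵇ i))) where

  crossing : V → V → Bool
  crossing u v = (S₁ u ∧ S₂ v) ∨ (S₂ u ∧ S₁ v)

  separated : GraphOn V
  separated = record
    { E = λ u v → E G u v ∧ not (crossing u v)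
    ; E-sym = λ u v → cong₂ (λ e x → e ∧ not x) (E-sym G u v)
                (trans (cong₂ _∨_ (∧-comm (S₁ u) _) (∧-comm (S₂ u) _)) (∨-comm (S₂ v ∧ S₁ u) _))
    ; E-irrefl = λ v → cong (_∧ not (crossing v v)) (E-irrefl G v) }

  separated-within₁ : ∀ {u v} → u ∈ S₁ → v ∈ S₁ → E separated u v ≡ E G u v
  separated-within₁ {u} u∈S₁ v∈S₁
    rewrite ∉⇒≡false (disjoint u∈S₁) | ∉⇒≡false (disjoint v∈S₁) | ∧-zeroʳ (S₁ u) = ∧-identityʳ _

  separated-within₂ : ∀ {u v} → u ∈ S₂ → v ∈ S₂ → E separated u v ≡ E G u v
  separated-within₂ {u} u∈S₂ v∈S₂
    rewrite ∉⇒≡false (λ u∈S₁ → disjoint u∈S₁ u∈S₂) | ∉⇒≡false (λ v∈S₁ → disjoint v∈S₁ v∈S₂) | ∧-zeroʳ (S₂ u) =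
      ∧-identityʳ _

  separated-across : ∀ {u v} → u ∈ S₁ → v ∈ S₂ → E separated u v ≡ false
  separated-across u∈S₁ v∈S₂ rewrite ∈⇒≡true u∈S₁ | ∈⇒≡true v∈S₂ = ∧-zeroʳ _

  bridges : ℕ → V → V → Bool
  bridges zero    u v = false
  bridges (suc m) u v = bridges m u v ∨ (C m ∧ joined c i m u v)

  bridges-sym : ∀ m u v → bridges m u v ≡ bridges m v u
  bridges-sym zero    u v = refl
  bridges-sym (suc m) u v = cong₂ _∨_ (bridges-sym m u v) (cong (C m ∧_) (joined-sym c i m u v))

  bridges-sound : ∀ m {u v} → T (bridges m u v) → ∃[ x ] x < m × T (C x) × T (joined c i x u v)
  bridges-sound (suc m) {u} {v} t with Equivalence.to (T-∨ {bridges m u v}) t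
  ... | inj₁ t′ = let x , x<m , rest = bridges-sound m t′ in x , ℕₚ.m<n⇒m<1+n x<m , rest
  ... | inj₂ t′ = m , ℕₚ.n<1+n m , Equivalence.to T-∧ t′

  bridges-complete : ∀ {m x u v} → x < m → T (C x) → T (joined c i x u v) → T (bridges m u v)
  bridges-complete {suc m} {u = u} {v} x<1+m Cx jx with ℕₚ.m<1+n⇒m<n∨m≡n x<1+m
  ... | inj₁ x<m  = Equivalence.from (T-∨ {bridges m u v}) (inj₁ (bridges-complete x<m Cx jx))
  ... | inj₂ refl = Equivalence.from (T-∨ {bridges m u v}) (inj₂ (Equivalence.from T-∧ (Cx , jx)))

  no-bridges : ∀ m {u v} → (∀ {x} → T (C x) → ¬ T (joined c i x u v)) → bridges m u v ≡ false
  no-bridges m none = ¬T⇒≡false λ t → let _ , _ , Cx , jx = bridges-sound m t in none Cx jx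

  bridged : ℕ → GraphOn V
  bridged m = record
    { E = λ u v → E separated u v ∨ bridges m u v
    ; E-sym = λ u v → cong₂ _∨_ (E-sym separated u v) (bridges-sym m u v)
    ; E-irrefl = λ v → cong₂ _∨_ (E-irrefl separated v) (no-bridges m (loop v)) }
    where
      loop : ∀ v {x} → T (C x) → ¬ T (joined c i x v v)
      loop v {x} Cx jx with joined⇒ {c = c} {i} {x} {v} {v} jx
      ... | inj₁ (cv≡i , cv≡x) = subst T (trans (cong C (trans (sym cv≡x) cv≡i)) i∉C) Cx
      ... | inj₂ (cv≡x , cv≡i) = subst T (trans (cong C (trans (sym cv≡x) cv≡i)) i∉C) Cx

  bridged₀ : Expressible k G S₁ c → Expressible k G S₂ c → ∃[ v₁ ] v₁ ∈ S₁ → ∃[ v₂ ] v₂ ∈ S₂ →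
             Expressible k (bridged 0) (S₁ ∪ S₂) c
  bridged₀ X₁ X₂ ne₁ ne₂ = Expressible-cong
    (Expressible-union {G = separated} (Expressible-cong X₁ id id separated-within₁ (λ _ → refl))
                                       (Expressible-cong X₂ id id separated-within₂ (λ _ → refl))
                                       ne₁ ne₂ disjoint separated-across)
    id id (λ _ _ → ∨-identityʳ _) (λ _ → refl)

  E-bridged-suc : ∀ {m x} u v → C m ≡ x →
                  E (bridged (suc m)) u v ≡ (E separated u v ∨ bridges m u v ∨ (x ∧ joined c i m u v))
  E-bridged-suc {m} u v Cm = cong (λ x → E separated u v ∨ bridges m u v ∨ (x ∧ joined c i m u v)) Cm

  bridged-suc : ∀ {m S} → m < k → Expressible k (bridged m) S c → Expressible k (bridged (suc m)) S c
  bridged-suc {m} m<k X with C m in Cm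
  ... | true  = Expressible-join i<k m<k i≢m X λ {u} {v} _ _ →
                  trans (E-bridged-suc u v Cm) (sym (∨-assoc (E separated u v) _ _))
    where
      i≢m : i ≢ m
      i≢m refl with () ← trans (sym Cm) i∉C
  ... | false = Expressible-cong X id id
                  (λ {u} {v} _ _ → trans (E-bridged-suc u v Cm) (cong (E separated u v ∨_) (∨-identityʳ _)))
                  (λ _ → refl)

  bridged-upto : ∀ {S} m → m ≤ k → Expressible k (bridged 0) S c → Expressible k (bridged m) S c
  bridged-upto zero    _   X = X
  bridged-upto (suc m) m<k X = bridged-suc m<k (bridged-upto m (ℕₚ.<⇒≤ m<k) X)

  within₁ : ∀ {u v} → u ∈ S₁ → v ∈ S₁ → E (bridged k) u v ≡ E G u v
  within₁ {u} {v} u∈S₁ v∈S₁ = trans (cong₂ _∨_ (separated-within₁ u∈S₁ v∈S₁) (no-bridges k none)) (∨-identityʳ _)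
    where
      none : ∀ {x} → T (C x) → ¬ T (joined c i x u v)
      none {x} _ jx with joined⇒ {c = c} {i} {x} {u} {v} jx
      ... | inj₁ (cu≡i , _) = S₁≢i u∈S₁ cu≡i
      ... | inj₂ (_ , cv≡i) = S₁≢i v∈S₁ cv≡i

  within₂ : ∀ {u v} → u ∈ S₂ → v ∈ S₂ → E (bridged k) u v ≡ E G u v
  within₂ {u} {v} u∈S₂ v∈S₂ = trans (cong₂ _∨_ (separated-within₂ u∈S₂ v∈S₂) (no-bridges k none)) (∨-identityʳ _)
    where
      none : ∀ {x} → T (C x) → ¬ T (joined c i x u v)
      none {x} Cx jx with joined⇒ {c = c} {i} {x} {u} {v} jx
      ... | inj₁ (_ , refl) = subst T (S₂∉C v∈S₂) Cx
      ... | inj₂ (refl , _) = subst T (S₂∉C u∈S₂) Cx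

  between : ∀ {u v} → u ∈ S₁ → v ∈ S₂ → E (bridged k) u v ≡ E G u v
  between {u} {v} u∈S₁ v∈S₂ =
    trans (cong (_∨ bridges k u v) (separated-across u∈S₁ v∈S₂)) (trans (T-ext to from) (sym (across u∈S₁ v∈S₂)))
    where
      to : T (bridges k u v) → T (C (c u) ∧ (c v ≡ᵇ i))
      to t with bridges-sound k t
      ... | x , _ , Cx , jx with joined⇒ {c = c} {i} {x} {u} {v} jx
      ...   | inj₁ (cu≡i , _)    = ⊥-elim (S₁≢i u∈S₁ cu≡i)
      ...   | inj₂ (refl , cv≡i) = Equivalence.from T-∧ (Cx , ≡⇒≡ᵇ (c v) i cv≡i)
      from : T (C (c u) ∧ (c v ≡ᵇ i)) → T (bridges k u v)
      from t = let Cu , cv≡i = Equivalence.to T-∧ t in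
        bridges-complete (S₁<k u∈S₁) Cu (joined⇐ {c = c} {u = u} refl (≡ᵇ⇒≡ (c v) i cv≡i))

  bridged-agrees : ∀ {u v} → u ∈ S₁ ∪ S₂ → v ∈ S₁ ∪ S₂ → E G u v ≡ E (bridged k) u v
  bridged-agrees {u} {v} u∈S v∈S with ∈-∪⁻ {S₁ = S₁} u∈S | ∈-∪⁻ {S₁ = S₁} v∈S
  ... | inj₁ u∈S₁ | inj₁ v∈S₁ = sym (within₁ u∈S₁ v∈S₁)
  ... | inj₂ u∈S₂ | inj₂ v∈S₂ = sym (within₂ u∈S₂ v∈S₂)
  ... | inj₁ u∈S₁ | inj₂ v∈S₂ = sym (between u∈S₁ v∈S₂)
  ... | inj₂ u∈S₂ | inj₁ v∈S₁ = trans (E-sym G u v) (trans (sym (between v∈S₁ u∈S₂)) (E-sym (bridged k) v u))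

Expressible-attach :
  ∀ {V k} {G : GraphOn V} {S₁ S₂ c} (i : ℕ) (C : ℕ → Bool) → i < k → C i ≡ false →
  Expressible k G S₁ c → Expressible k G S₂ c → ∃[ v₁ ] v₁ ∈ S₁ → ∃[ v₂ ] v₂ ∈ S₂ → Disjoint S₁ S₂ →
  (∀ {u} → u ∈ S₁ → c u ≢ i) → (∀ {v} → v ∈ S₂ → C (c v) ≡ false) →
  (∀ {u v} → u ∈ S₁ → v ∈ S₂ → E G u v ≡ (C (c u) ∧ (c v ≡ᵇ i))) →
  Expressible k G (S₁ ∪ S₂) c
Expressible-attach {k = k} i C i<k i∉C X₁ X₂ ne₁ ne₂ disjoint S₁≢i S₂∉C across =
  Expressible-cong (bridged-upto k ℕₚ.≤-refl (bridged₀ X₁ X₂ ne₁ ne₂)) id id bridged-agrees (λ _ → refl)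
  where open Attach i C i<k i∉C disjoint S₁≢i (Expressible.colour-< X₁) S₂∉C across

Expressible⇒CliquewidthAtMost :
  ∀ {V k m} {H : GraphOn V} {S c} {G : Graph m} → Expressible k H S c → (φ : V → Fin m) →
  (∀ {u v} → u ∈ S → v ∈ S → φ u ≡ φ v → u ≡ v) → (∀ w → ∃[ v ] v ∈ S × φ v ≡ w) →
  (∀ {u v} → u ∈ S → v ∈ S → adj G (φ u) (φ v) ≡ E H u v) → CliquewidthAtMost G k
Expressible⇒CliquewidthAtMost {k = k} {m} {H} {G = G} X φ φ-injective φ-onto φ-adj =
  k , ℕₚ.≤-refl , colour ∘ g , CWPair-transport (φ ∘ vertex) g fg gf pair adj≡
  where
    open Expressible X
    g : Fin m → Fin size
    g w = proj₁ (vertex-onto (proj₁ (proj₂ (φ-onto w))))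
    fg : ∀ w → φ (vertex (g w)) ≡ w
    fg w = trans (cong φ (proj₂ (vertex-onto (proj₁ (proj₂ (φ-onto w)))))) (proj₂ (proj₂ (φ-onto w)))
    gf : ∀ x → g (φ (vertex x)) ≡ x
    gf x = vertex-injective (φ-injective (vertex-∈ _) (vertex-∈ x) (fg (φ (vertex x))))
    adj≡ : ∀ w w′ → adj G w w′ ≡ E H (vertex (g w)) (vertex (g w′))
    adj≡ w w′ = trans (cong₂ (adj G) (sym (fg w)) (sym (fg w′))) (φ-adj (vertex-∈ _) (vertex-∈ _))

-- The standard subdivision of K_n with path lengths L

-- inner i j t is the t-th vertex on the path from branch i to branch j.
data Site : Set where
  branch : ℕ → Site
  inner  : ℕ → ℕ → ℕ → Site

_≟ˢ_ : DecidableEquality Site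
branch l ≟ˢ branch l′ = map′ (cong branch) (λ { refl → refl }) (l ≟ℕ l′)
branch _ ≟ˢ inner _ _ _ = no λ ()
inner _ _ _ ≟ˢ branch _ = no λ ()
inner i j t ≟ˢ inner i′ j′ t′ =
  map′ (λ { (refl , refl , refl) → refl }) (λ { refl → refl , refl , refl }) (i ≟ℕ i′ ×-dec j ≟ℕ j′ ×-dec t ≟ℕ t′)

⁅_⁆ : Site → Subset Site
⁅ v ⁆ u = ⌊ u ≟ˢ v ⌋

∈⁅⁆ : ∀ v → v ∈ ⁅ v ⁆
∈⁅⁆ v = member (fromWitness refl)

∈⁅⁆⁻ : ∀ {u v} → u ∈ ⁅ v ⁆ → u ≡ v
∈⁅⁆⁻ = toWitness ∘ holds

module StandardSubdivision (n : ℕ) (L : ℕ → ℕ → ℕ) where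

  next : Site → Site → Bool
  next (branch l)    (branch l′)      = (l <ᵇ l′) ∧ (L l l′ ≡ᵇ 1)
  next (branch l)    (inner i _ t)    = (l ≡ᵇ i) ∧ (t ≡ᵇ 1)
  next (inner i j t) (branch l)       = (j ≡ᵇ l) ∧ (suc t ≡ᵇ L i j)
  next (inner i j t) (inner i′ j′ t′) = (i ≡ᵇ i′) ∧ (j ≡ᵇ j′) ∧ (suc t ≡ᵇ t′)

  next-irrefl : ∀ v → next v v ≡ false
  next-irrefl (branch l) = cong (_∧ (L l l ≡ᵇ 1)) (<ᵇ-false {l} ℕₚ.≤-refl)
  next-irrefl (inner i j t) rewrite ≡ᵇ-true {i} refl | ≡ᵇ-true {j} refl | ≡ᵇ-false (ℕₚ.1+n≢n {t}) = refl

  subdivision : GraphOn Site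
  subdivision = record
    { E = λ u v → next u v ∨ next v u
    ; E-sym = λ u v → ∨-comm (next u v) (next v u)
    ; E-irrefl = λ v → cong₂ _∨_ (next-irrefl v) (next-irrefl v) }

  E-along : ∀ i j t t′ → E subdivision (inner i j t) (inner i j t′) ≡ (suc t ≡ᵇ t′) ∨ (suc t′ ≡ᵇ t)
  E-along i j t t′ rewrite ≡ᵇ-true {i} refl | ≡ᵇ-true {j} refl = refl

  E-apart : ∀ {i j t i′ j′ t′} → i ≢ i′ ⊎ j ≢ j′ → E subdivision (inner i j t) (inner i′ j′ t′) ≡ false
  E-apart (inj₁ i≢i′) rewrite ≡ᵇ-false i≢i′ | ≡ᵇ-false (i≢i′ ∘ sym) = refl
  E-apart {i} {i′ = i′} (inj₂ j≢j′) rewrite ≡ᵇ-false j≢j′ | ≡ᵇ-false (j≢j′ ∘ sym) =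
    cong₂ _∨_ (∧-zeroʳ (i ≡ᵇ i′)) (∧-zeroʳ (i′ ≡ᵇ i))

  ValidInner : ℕ → ℕ → ℕ → Set
  ValidInner i j t = i < j × j < n × 0 < t × t < L i j

  validInner? : ∀ i j t → Dec (ValidInner i j t)
  validInner? i j t = i <? j ×-dec j <? n ×-dec 0 <? t ×-dec t <? L i j

  Valid : Subset Site
  Valid (branch l)    = ⌊ l <? n ⌋
  Valid (inner i j t) = ⌊ validInner? i j t ⌋

  onPath : ℕ → ℕ → ℕ → Site
  onPath i j zero    = branch i
  onPath i j (suc t) = if suc t ≡ᵇ L i j then branch j else inner i j (suc t)

  onPath-inner : ∀ {i j t} → 0 < t → t < L i j → onPath i j t ≡ inner i j t
  onPath-inner {t = suc t} _ t<L rewrite ≡ᵇ-false (ℕₚ.<⇒≢ t<L) = refl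

  onPath-last : ∀ {i j t} → suc t ≡ L i j → onPath i j (suc t) ≡ branch j
  onPath-last 1+t≡L rewrite ≡ᵇ-true 1+t≡L = refl

  onPath-valid : ∀ {i j t} → i < j → j < n → t ≤ L i j → onPath i j t ∈ Valid
  onPath-valid {t = zero} i<j j<n _ = member (fromWitness (ℕₚ.<-trans i<j j<n))
  onPath-valid {i} {j} {suc t} i<j j<n t≤L with suc t ≟ℕ L i j
  ... | yes 1+t≡L rewrite onPath-last {i} {j} 1+t≡L = member (fromWitness j<n)
  ... | no 1+t≢L rewrite onPath-inner {i} {j} {suc t} (s≤s z≤n) (ℕₚ.≤∧≢⇒< t≤L 1+t≢L) =
    member (fromWitness (i<j , j<n , s≤s z≤n , ℕₚ.≤∧≢⇒< t≤L 1+t≢L))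

  data Step : Site → Site → Set where
    step : ∀ {i j t} → i < j → j < n → t < L i j → Step (onPath i j t) (onPath i j (suc t))

  Step⇒next : ∀ {u v} → Step u v → T (next u v)
  Step⇒next (step {i} {j} {zero} i<j _ 0<L) with 1 ≟ℕ L i j
  ... | yes 1≡L rewrite onPath-last {i} {j} 1≡L | <ᵇ-true i<j | ≡ᵇ-true (sym 1≡L) = _
  ... | no 1≢L rewrite onPath-inner {i} {j} {1} (s≤s z≤n) (ℕₚ.≤∧≢⇒< 0<L 1≢L) | ≡ᵇ-true {i} refl = _
  Step⇒next (step {i} {j} {suc t} _ _ t<L) with suc (suc t) ≟ℕ L i j
  ... | yes 2+t≡L rewrite onPath-inner {i} {j} {suc t} (s≤s z≤n) t<L | onPath-last {i} {j} 2+t≡L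
                        | ≡ᵇ-true {j} refl | ≡ᵇ-true 2+t≡L = _
  ... | no 2+t≢L rewrite onPath-inner {i} {j} {suc t} (s≤s z≤n) t<L
                       | onPath-inner {i} {j} {suc (suc t)} (s≤s z≤n) (ℕₚ.≤∧≢⇒< t<L 2+t≢L)
                       | ≡ᵇ-true {i} refl | ≡ᵇ-true {j} refl | ≡ᵇ-true {t} refl = _

  next⇒Step : ∀ {u v} → u ∈ Valid → v ∈ Valid → T (next u v) → Step u v
  next⇒Step {branch l} {branch l′} _ (member v∈) h with Equivalence.to T-∧ h
  ... | l<l′ , L≡ᵇ1 = subst (Step (branch l)) (onPath-last (sym L≡1))
                        (step (ℕₚ.<ᵇ⇒< l l′ l<l′) (toWitness v∈) (subst (0 <_) (sym L≡1) (s≤s z≤n)))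
    where
      L≡1 : L l l′ ≡ 1
      L≡1 = ≡ᵇ⇒≡ (L l l′) 1 L≡ᵇ1
  next⇒Step {branch l} {inner i j t} _ (member v∈) h with Equivalence.to T-∧ h
  ... | l≡i , t≡1 with ≡ᵇ⇒≡ l i l≡i | ≡ᵇ⇒≡ t 1 t≡1 | toWitness v∈
  ...   | refl | refl | i<j , j<n , _ , 1<L =
    subst (Step (branch i)) (onPath-inner (s≤s z≤n) 1<L) (step i<j j<n (ℕₚ.<-trans (s≤s z≤n) 1<L))
  next⇒Step {inner i j t} {branch l} (member u∈) _ h with Equivalence.to T-∧ h
  ... | j≡l , 1+t≡L with ≡ᵇ⇒≡ j l j≡l | toWitness u∈
  ...   | refl | i<j , j<n , 0<t , t<L =
    subst₂ Step (onPath-inner 0<t t<L) (onPath-last (≡ᵇ⇒≡ (suc t) (L i j) 1+t≡L)) (step i<j j<n t<L)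
  next⇒Step {inner i j t} {inner i′ j′ t′} (member u∈) (member v∈) h with Equivalence.to T-∧ h
  ... | i≡i′ , rest with Equivalence.to T-∧ rest
  ...   | j≡j′ , 1+t≡t′
    with ≡ᵇ⇒≡ i i′ i≡i′ | ≡ᵇ⇒≡ j j′ j≡j′ | ≡ᵇ⇒≡ (suc t) t′ 1+t≡t′ | toWitness u∈ | toWitness v∈
  ...     | refl | refl | refl | i<j , j<n , 0<t , t<L | _ , _ , _ , 1+t<L =
    subst₂ Step (onPath-inner 0<t t<L) (onPath-inner (s≤s z≤n) 1+t<L) (step i<j j<n t<L)

-- Building the standard subdivision with n + 2 colours

module Construction (n : ℕ) (L : ℕ → ℕ → ℕ) (2≤n : 2 ≤ n) where
  open StandardSubdivision n L

  k dead live : ℕ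
  k    = suc (suc n)
  dead = n
  live = suc n

  colour<k : ∀ {x} → x ≤ live → x < k
  colour<k = s≤s

  0<k : 0 < k
  0<k = colour<k z≤n

  1<k : 1 < k
  1<k = colour<k (s≤s z≤n)

  dead<k : dead < k
  dead<k = colour<k (ℕₚ.n≤1+n n)

  live<k : live < k
  live<k = colour<k ℕₚ.≤-refl

  dead≢0 : dead ≢ 0
  dead≢0 = ℕₚ.>⇒≢ (ℕₚ.<-trans (s≤s z≤n) 2≤n)

  dead≢1 : dead ≢ 1
  dead≢1 = ℕₚ.>⇒≢ 2≤n

  live≢1 : live ≢ 1
  live≢1 = ℕₚ.>⇒≢ (ℕₚ.m<n⇒m<1+n 2≤n)

  -- Colour functions are total: on the vertex about to be attached (inner I J (suc b) for
  -- segmentColour b, branch J for stageColour J) they already give the colour it enters with.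

  Segment : ℕ → ℕ → ℕ → Subset Site
  Segment I J b (branch _)    = false
  Segment I J b (inner i j t) = ⌊ i ≟ℕ I ×-dec j ≟ℕ J ×-dec 0 <? t ×-dec t ≤? b ⌋

  segmentColourAt : ℕ → ℕ → ℕ
  segmentColourAt b t = if t ≡ᵇ 1 then live else if t ≡ᵇ b then 0 else if t ≡ᵇ suc b then 1 else dead

  segmentColour : ℕ → Site → ℕ
  segmentColour b (branch _)    = dead
  segmentColour b (inner _ _ t) = segmentColourAt b t

  segment-∈⁻ : ∀ {I J b v} → v ∈ Segment I J b → ∃[ t ] v ≡ inner I J t × 0 < t × t ≤ b
  segment-∈⁻ {v = inner i j t} (member h) with toWitness h
  ... | refl , refl , 0<t , t≤b = t , refl , 0<t , t≤b

  segment-∈ : ∀ {I J b t} → 0 < t → t ≤ b → inner I J t ∈ Segment I J b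
  segment-∈ 0<t t≤b = member (fromWitness (refl , refl , 0<t , t≤b))

  segmentColourAt-≢1 : ∀ {b t} → t ≤ b → segmentColourAt b t ≢ 1
  segmentColourAt-≢1 {b} {t} t≤b rewrite ≡ᵇ-false (ℕₚ.<⇒≢ (s≤s t≤b)) with t ≡ᵇ 1 | t ≡ᵇ b
  ... | true  | _     = live≢1
  ... | false | true  = λ ()
  ... | false | false = dead≢1

  segmentColourAt-new : ∀ {b} → 1 ≤ b → segmentColourAt b (suc b) ≡ 1
  segmentColourAt-new {b} 1≤b
    rewrite ≡ᵇ-false (ℕₚ.<⇒≢ (s≤s 1≤b) ∘ sym) | ≡ᵇ-false (ℕₚ.1+n≢n {b}) | ≡ᵇ-true {suc b} refl = refl

  segmentColourAt-last : ∀ {b t} → 0 < t → t ≤ b → (t ≡ᵇ b) ≡ (segmentColourAt b t ≡ᵇ segmentColourAt b b)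
  segmentColourAt-last {b} {t} 0<t t≤b with t ≟ℕ b
  ... | yes refl = trans (≡ᵇ-true {t} refl) (sym (≡ᵇ-true {segmentColourAt t t} refl))
  ... | no t≢b rewrite ≡ᵇ-false t≢b | ≡ᵇ-false (ℕₚ.<⇒≢ (s≤s t≤b))
                     | ≡ᵇ-false {b} {1} (ℕₚ.>⇒≢ (ℕₚ.≤-<-trans 0<t (ℕₚ.≤∧≢⇒< t≤b t≢b))) | ≡ᵇ-true {b} refl
    with t ≡ᵇ 1
  ...   | true  = refl
  ...   | false = sym (≡ᵇ-false dead≢0)

  segmentColourAt-suc : ∀ {b t} → 1 ≤ b → 0 < t → t ≤ suc b →
                        segmentColourAt (suc b) t ≡ (segmentColourAt b [ 0 ↦ dead ] [ 1 ↦ 0 ]) t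
  segmentColourAt-suc {b} {t} 1≤b 0<t t≤1+b rewrite ≡ᵇ-false (ℕₚ.<⇒≢ (s≤s t≤1+b)) with t ≟ℕ 1
  ... | yes refl rewrite ≡ᵇ-false dead≢0 = refl
  ... | no t≢1 rewrite ≡ᵇ-false t≢1 with t ≟ℕ suc b
  ...   | yes refl rewrite ≡ᵇ-true {t} refl | ≡ᵇ-false (ℕₚ.1+n≢n {b}) = refl
  ...   | no t≢1+b rewrite ≡ᵇ-false t≢1+b with t ≟ℕ b
  ...     | yes refl rewrite ≡ᵇ-true {t} refl | ≡ᵇ-false dead≢1 = refl
  ...     | no t≢b rewrite ≡ᵇ-false t≢b | ≡ᵇ-false dead≢0 | ≡ᵇ-false dead≢1 = refl

  module SegmentGrowth {I J b : ℕ} (1≤b : 1 ≤ b) where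

    new : Site
    new = inner I J (suc b)

    disjoint : Disjoint (Segment I J b) ⁅ new ⁆
    disjoint u∈ u∈⁅new⁆ with ∈⁅⁆⁻ u∈⁅new⁆ | segment-∈⁻ u∈
    ... | refl | _ , refl , _ , 1+b≤b = ℕₚ.1+n≰n 1+b≤b

    old≢1 : ∀ {u} → u ∈ Segment I J b → segmentColour b u ≢ 1
    old≢1 u∈ with segment-∈⁻ u∈
    ... | _ , refl , _ , t≤b = segmentColourAt-≢1 t≤b

    new∉C : ∀ {v} → v ∈ ⁅ new ⁆ → (segmentColour b v ≡ᵇ segmentColourAt b b) ≡ false
    new∉C v∈ rewrite ∈⁅⁆⁻ v∈ | segmentColourAt-new 1≤b = ≡ᵇ-false (segmentColourAt-≢1 {b} ℕₚ.≤-refl ∘ sym)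

    across : ∀ {u v} → u ∈ Segment I J b → v ∈ ⁅ new ⁆ →
             E subdivision u v ≡ ((segmentColour b u ≡ᵇ segmentColourAt b b) ∧ (segmentColour b v ≡ᵇ 1))
    across u∈ v∈ with segment-∈⁻ u∈ | ∈⁅⁆⁻ v∈
    ... | t , refl , 0<t , t≤b | refl rewrite segmentColourAt-new 1≤b =
      trans (E-along I J t (suc b))
        (trans (cong ((t ≡ᵇ b) ∨_) (≡ᵇ-false (ℕₚ.>⇒≢ (s≤s (ℕₚ.m≤n⇒m≤1+n t≤b)))))
          (trans (∨-identityʳ _) (trans (segmentColourAt-last 0<t t≤b) (sym (∧-identityʳ _)))))

    grow : Segment I J b ∪ ⁅ new ⁆ ⊆ Segment I J (suc b)
    grow v∈ with ∈-∪⁻ {S₁ = Segment I J b} v∈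
    ... | inj₂ v∈⁅new⁆ rewrite ∈⁅⁆⁻ v∈⁅new⁆ = segment-∈ (s≤s z≤n) ℕₚ.≤-refl
    ... | inj₁ v∈S with segment-∈⁻ v∈S
    ...   | t , refl , 0<t , t≤b = segment-∈ 0<t (ℕₚ.m≤n⇒m≤1+n t≤b)

    shrink : Segment I J (suc b) ⊆ Segment I J b ∪ ⁅ new ⁆
    shrink v∈ with segment-∈⁻ v∈
    ... | t , refl , 0<t , t≤1+b with ℕₚ.m≤n⇒m<n∨m≡n t≤1+b
    ...   | inj₁ (s≤s t≤b) = ∈-∪ˡ (segment-∈ 0<t t≤b)
    ...   | inj₂ refl      = ∈-∪ʳ {S₁ = Segment I J b} (∈⁅⁆ new)

    recoloured : ∀ {v} → v ∈ Segment I J b ∪ ⁅ new ⁆ →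
                 segmentColour (suc b) v ≡ (segmentColour b [ 0 ↦ dead ] [ 1 ↦ 0 ]) v
    recoloured v∈ with segment-∈⁻ (grow v∈)
    ... | t , refl , 0<t , t≤1+b = segmentColourAt-suc 1≤b 0<t t≤1+b

  segment-suc : ∀ {I J b} → 1 ≤ b → Expressible k subdivision (Segment I J b) (segmentColour b) →
                Expressible k subdivision (Segment I J (suc b)) (segmentColour (suc b))
  segment-suc {I} {J} {b} 1≤b X =
    Expressible-cong (Expressible-recolour 1<k 0<k (Expressible-recolour 0<k dead<k attached))
      grow shrink (λ _ _ → refl) recoloured
    where
      open SegmentGrowth {I} {J} {b} 1≤b
      attached : Expressible k subdivision (Segment I J b ∪ ⁅ new ⁆) (segmentColour b)
      attached = Expressible-attach 1 (_≡ᵇ segmentColourAt b b) 1<k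
        (≡ᵇ-false (segmentColourAt-≢1 {b} ℕₚ.≤-refl ∘ sym)) X
        (Expressible-singleton new (∈⁅⁆ new) ∈⁅⁆⁻ (subst (_< k) (sym (segmentColourAt-new 1≤b)) 1<k))
        (inner I J 1 , segment-∈ (s≤s z≤n) 1≤b) (new , ∈⁅⁆ new) disjoint old≢1 new∉C across

  segment : ∀ I J b → 1 ≤ b → Expressible k subdivision (Segment I J b) (segmentColour b)
  segment I J 1 _ = Expressible-singleton (inner I J 1) (segment-∈ (s≤s z≤n) (s≤s z≤n)) only live<k
    where
      only : ∀ {u} → u ∈ Segment I J 1 → u ≡ inner I J 1
      only u∈ with segment-∈⁻ u∈
      ... | 1 , refl , _ , _ = refl
      ... | suc (suc _) , _ , _ , s≤s ()
  segment I J (suc (suc b)) _ = segment-suc (s≤s z≤n) (segment I J (suc b) (s≤s z≤n))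

  inStage? : ∀ J I i j t → Dec (ValidInner i j t × (j < J ⊎ (j ≡ J × i < I)))
  inStage? J I i j t = validInner? i j t ×-dec (j <? J ⊎-dec (j ≟ℕ J ×-dec i <? I))

  Stage : ℕ → ℕ → Subset Site
  Stage J I (branch l)    = ⌊ l <? J ⌋
  Stage J I (inner i j t) = ⌊ inStage? J I i j t ⌋

  inner∈stage : ∀ {J I i j t} → ValidInner i j t → j < J ⊎ (j ≡ J × i < I) → inner i j t ∈ Stage J I
  inner∈stage valid position = member (fromWitness (valid , position))

  stageColour : ℕ → Site → ℕ
  stageColour J (branch l)    = if l ≡ᵇ J then live else l
  stageColour J (inner i j t) = if (j ≡ᵇ J) ∧ (suc t ≡ᵇ L i j) then J else dead

  stageColour-≢live : ∀ {J I v} → J < n → v ∈ Stage J I → stageColour J v ≢ live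
  stageColour-≢live {J} {v = branch l} J<n v∈ rewrite ≡ᵇ-false (ℕₚ.<⇒≢ (toWitness (holds v∈))) =
    ℕₚ.<⇒≢ (ℕₚ.<-trans (toWitness (holds v∈)) (ℕₚ.m<n⇒m<1+n J<n))
  stageColour-≢live {J} {v = inner i j t} J<n _ with (j ≡ᵇ J) ∧ (suc t ≡ᵇ L i j)
  ... | true  = ℕₚ.<⇒≢ (ℕₚ.m<n⇒m<1+n J<n)
  ... | false = ℕₚ.1+n≢n ∘ sym

  stageColour-inner≤dead : ∀ {J i j t} → J ≤ n → stageColour J (inner i j t) ≤ dead
  stageColour-inner≤dead {J} {i} {j} {t} J≤n with (j ≡ᵇ J) ∧ (suc t ≡ᵇ L i j)
  ... | true  = J≤n
  ... | false = ℕₚ.≤-refl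

  stageColour-inner-≢ : ∀ {J I i j t} → I < J → J < n → stageColour J (inner i j t) ≢ I
  stageColour-inner-≢ {J} {I} {i} {j} {t} I<J J<n with (j ≡ᵇ J) ∧ (suc t ≡ᵇ L i j)
  ... | true  = ℕₚ.>⇒≢ I<J
  ... | false = ℕₚ.>⇒≢ (ℕₚ.<-trans I<J J<n)

  stage-mono : ∀ {J I} → Stage J I ⊆ Stage J (suc I)
  stage-mono {v = branch l}    (member h) = member h
  stage-mono {v = inner i j t} (member h) with toWitness h
  ... | valid , inj₁ j<J         = inner∈stage valid (inj₁ j<J)
  ... | valid , inj₂ (j≡J , i<I) = inner∈stage valid (inj₂ (j≡J , ℕₚ.m<n⇒m<1+n i<I))

  stage-skip : ∀ {J I} → L I J ≤ 1 → Stage J (suc I) ⊆ Stage J I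
  stage-skip _ {branch l} (member h) = member h
  stage-skip L≤1 {inner i j t} (member h) with toWitness h
  ... | valid , inj₁ j<J = inner∈stage valid (inj₁ j<J)
  ... | valid , inj₂ (j≡J , i<1+I) with ℕₚ.m<1+n⇒m<n∨m≡n i<1+I
  ...   | inj₁ i<I = inner∈stage valid (inj₂ (j≡J , i<I))
  ...   | inj₂ refl with j≡J | valid
  ...     | refl | _ , _ , 0<t , t<L = ⊥-elim (ℕₚ.<-irrefl refl (ℕₚ.<-≤-trans (ℕₚ.<-≤-trans (s≤s 0<t) t<L) L≤1))

  attachColour : ℕ → ℕ → Site → ℕ
  attachColour J I v = if ⌊ v ≟ˢ inner I J 1 ⌋ then live else stageColour J v

  attachColour-first : ∀ J I → attachColour J I (inner I J 1) ≡ live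
  attachColour-first J I with inner I J 1 ≟ˢ inner I J 1
  ... | yes _ = refl
  ... | no ≢  = ⊥-elim (≢ refl)

  attachColour-other : ∀ {J I v} → v ≢ inner I J 1 → attachColour J I v ≡ stageColour J v
  attachColour-other {J} {I} {v} v≢ with v ≟ˢ inner I J 1
  ... | yes v≡ = ⊥-elim (v≢ v≡)
  ... | no _   = refl

  attachColour-inner-≢ : ∀ {J I i j t} → I < J → J < n → attachColour J I (inner i j t) ≢ I
  attachColour-inner-≢ {J} {I} {i} {j} {t} I<J J<n with inner i j t ≟ˢ inner I J 1
  ... | yes _ = ℕₚ.>⇒≢ (ℕₚ.<-trans (ℕₚ.<-trans I<J J<n) (ℕₚ.n<1+n n))
  ... | no _  = stageColour-inner-≢ I<J J<n

  module PathAttachment {J I b : ℕ} (I<J : I < J) (J<n : J < n) (L≡ : L I J ≡ suc b) (1≤b : 1 ≤ b) where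

    first : Site
    first = inner I J 1

    first∈ : first ∈ Segment I J b
    first∈ = segment-∈ (s≤s z≤n) 1≤b

    J<k : J < k
    J<k = colour<k (ℕₚ.m≤n⇒m≤1+n (ℕₚ.<⇒≤ J<n))

    first-colour<k : stageColour J first < k
    first-colour<k = colour<k (ℕₚ.m≤n⇒m≤1+n (stageColour-inner≤dead {J} {I} {J} {1} (ℕₚ.<⇒≤ J<n)))

    segment∉stage : ∀ {v} → v ∈ Segment I J b → ¬ v ∈ Stage J I
    segment∉stage v∈seg v∈stage with segment-∈⁻ v∈seg
    ... | t , refl , _ , _ with toWitness (holds v∈stage)
    ...   | _ , inj₁ J<J       = ℕₚ.<-irrefl refl J<J
    ...   | _ , inj₂ (_ , I<I) = ℕₚ.<-irrefl refl I<I

    stage≢first : ∀ {u} → u ∈ Stage J I → u ≢ first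
    stage≢first u∈ refl = segment∉stage first∈ u∈

    onStage : Expressible k subdivision (Stage J I) (stageColour J) →
              Expressible k subdivision (Stage J I) (attachColour J I)
    onStage X = Expressible-cong X id id (λ _ _ → refl) (attachColour-other ∘ stage≢first)

    onSegment : Expressible k subdivision (Segment I J b) (attachColour J I)
    onSegment = Expressible-cong (Expressible-recolour 0<k J<k (segment I J b 1≤b)) id id (λ _ _ → refl) coloured
      where
        colourAt : ∀ {t} → 0 < t → t ≤ b →
                   attachColour J I (inner I J t) ≡ (segmentColour b [ 0 ↦ J ]) (inner I J t)
        colourAt {1} _ _ = attachColour-first J I
        colourAt {suc (suc t)} _ t≤b
          rewrite attachColour-other {J} {I} {inner I J (suc (suc t))} (λ ()) | L≡ | ≡ᵇ-true {J} refl
                | ≡ᵇ-false (ℕₚ.<⇒≢ (s≤s t≤b)) with suc (suc t) ≡ᵇ b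
        ... | true  = refl
        ... | false rewrite ≡ᵇ-false dead≢0 = refl
        coloured : ∀ {v} → v ∈ Segment I J b → attachColour J I v ≡ (segmentColour b [ 0 ↦ J ]) v
        coloured v∈ with segment-∈⁻ v∈
        ... | t , refl , 0<t , t≤b = colourAt 0<t t≤b

    stage≢live : ∀ {u} → u ∈ Stage J I → attachColour J I u ≢ live
    stage≢live u∈ = stageColour-≢live J<n u∈ ∘ trans (sym (attachColour-other (stage≢first u∈)))

    segment≢I : ∀ {v} → v ∈ Segment I J b → (attachColour J I v ≡ᵇ I) ≡ false
    segment≢I v∈ with segment-∈⁻ v∈
    ... | t , refl , _ , _ = ≡ᵇ-false (attachColour-inner-≢ {i = I} {J} {t} I<J J<n)

    segment-live : ∀ t → (attachColour J I (inner I J t) ≡ᵇ live) ≡ (t ≡ᵇ 1)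
    segment-live 0 rewrite attachColour-other {J} {I} {inner I J 0} (λ ()) =
      ≡ᵇ-false (ℕₚ.<⇒≢ (s≤s (stageColour-inner≤dead {J} {I} {J} {0} (ℕₚ.<⇒≤ J<n))))
    segment-live 1 rewrite attachColour-first J I = ≡ᵇ-true {live} refl
    segment-live (suc (suc t)) rewrite attachColour-other {J} {I} {inner I J (suc (suc t))} (λ ()) =
      ≡ᵇ-false (ℕₚ.<⇒≢ (s≤s (stageColour-inner≤dead {J} {I} {J} {suc (suc t)} (ℕₚ.<⇒≤ J<n))))

    across : ∀ {u v} → u ∈ Stage J I → v ∈ Segment I J b →
             E subdivision u v ≡ ((attachColour J I u ≡ᵇ I) ∧ (attachColour J I v ≡ᵇ live))
    across {u} u∈ v∈ with segment-∈⁻ v∈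
    ... | t , refl , _ , _ rewrite attachColour-other (stage≢first u∈) | segment-live t = edge u u∈
      where
        edge : ∀ u → u ∈ Stage J I → E subdivision u (inner I J t) ≡ ((stageColour J u ≡ᵇ I) ∧ (t ≡ᵇ 1))
        edge (branch l) (member h)
          rewrite ≡ᵇ-false {l} {J} (ℕₚ.<⇒≢ (toWitness h)) | ≡ᵇ-false {J} {l} (ℕₚ.>⇒≢ (toWitness h)) =
            ∨-identityʳ _
        edge (inner i j t′) (member h) = trans (E-apart {i} {j} {t′} {I} {J} {t} (otherPath (proj₂ (toWitness h))))
          (sym (cong (_∧ (t ≡ᵇ 1)) (≡ᵇ-false (stageColour-inner-≢ {i = i} {j} {t′} I<J J<n))))
          where
            otherPath : j < J ⊎ (j ≡ J × i < I) → i ≢ I ⊎ j ≢ J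
            otherPath (inj₁ j<J)       = inj₂ (ℕₚ.<⇒≢ j<J)
            otherPath (inj₂ (_ , i<I)) = inj₁ (ℕₚ.<⇒≢ i<I)

    grow : Stage J I ∪ Segment I J b ⊆ Stage J (suc I)
    grow v∈ with ∈-∪⁻ {S₁ = Stage J I} v∈
    ... | inj₁ v∈stage = stage-mono v∈stage
    ... | inj₂ v∈seg with segment-∈⁻ v∈seg
    ...   | t , refl , 0<t , t≤b =
      inner∈stage (I<J , J<n , 0<t , subst (t <_) (sym L≡) (s≤s t≤b)) (inj₂ (refl , ℕₚ.n<1+n I))

    shrink : Stage J (suc I) ⊆ Stage J I ∪ Segment I J b
    shrink {branch l} (member h) = ∈-∪ˡ {S₂ = Segment I J b} (member h)
    shrink {inner i j t} (member h) with toWitness h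
    ... | valid , inj₁ j<J = ∈-∪ˡ {S₂ = Segment I J b} (inner∈stage valid (inj₁ j<J))
    ... | valid , inj₂ (j≡J , i<1+I) with ℕₚ.m<1+n⇒m<n∨m≡n i<1+I
    ...   | inj₁ i<I = ∈-∪ˡ {S₂ = Segment I J b} (inner∈stage valid (inj₂ (j≡J , i<I)))
    ...   | inj₂ refl with j≡J | valid
    ...     | refl | _ , _ , 0<t , t<L = ∈-∪ʳ {S₁ = Stage J I} (segment-∈ 0<t (ℕₚ.≤-pred (subst (t <_) L≡ t<L)))

    recoloured : ∀ {v} → v ∈ Stage J I ∪ Segment I J b →
                 stageColour J v ≡ (attachColour J I [ live ↦ stageColour J first ]) v
    recoloured {v} v∈ with v ≟ˢ first
    ... | yes refl rewrite ≡ᵇ-true {live} refl = refl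
    ... | no _     rewrite ≡ᵇ-false (stageColour-≢live J<n (grow v∈)) = refl

  stage-path-attach : ∀ {J I b} → I < J → J < n → L I J ≡ suc b → 1 ≤ b →
                      Expressible k subdivision (Stage J I) (stageColour J) →
                      Expressible k subdivision (Stage J (suc I)) (stageColour J)
  stage-path-attach {J} {I} {b} I<J J<n L≡ 1≤b X =
    Expressible-cong (Expressible-recolour live<k first-colour<k attached) grow shrink (λ _ _ → refl) recoloured
    where
      open PathAttachment I<J J<n L≡ 1≤b
      attached : Expressible k subdivision (Stage J I ∪ Segment I J b) (attachColour J I)
      attached = Expressible-attach live (_≡ᵇ I) live<k
        (≡ᵇ-false (ℕₚ.>⇒≢ (ℕₚ.<-trans (ℕₚ.<-trans I<J J<n) (ℕₚ.n<1+n n))))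
        (onStage X) onSegment (branch 0 , member (fromWitness (ℕₚ.≤-<-trans z≤n I<J))) (first , first∈)
        (λ u∈stage u∈seg → segment∉stage u∈seg u∈stage) stage≢live segment≢I across

  stage-no-path : ∀ {J I} → L I J ≤ 1 → Expressible k subdivision (Stage J I) (stageColour J) →
                  Expressible k subdivision (Stage J (suc I)) (stageColour J)
  stage-no-path L≤1 X = Expressible-cong X stage-mono (stage-skip L≤1) (λ _ _ → refl) (λ _ → refl)

  stage-path : ∀ {J I} → I < J → J < n → Expressible k subdivision (Stage J I) (stageColour J) →
               Expressible k subdivision (Stage J (suc I)) (stageColour J)
  stage-path {J} {I} I<J J<n X with L I J in L≡
  ... | 0           = stage-no-path (subst (_≤ 1) (sym L≡) z≤n) X
  ... | 1           = stage-no-path (subst (_≤ 1) (sym L≡) ℕₚ.≤-refl) X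
  ... | suc (suc b) = stage-path-attach I<J J<n L≡ (s≤s z≤n) X

  stage-paths : ∀ {J} → J < n → ∀ I → I ≤ J → Expressible k subdivision (Stage J 0) (stageColour J) →
                Expressible k subdivision (Stage J I) (stageColour J)
  stage-paths J<n zero    _   X = X
  stage-paths J<n (suc I) I<J X = stage-path I<J J<n (stage-paths J<n I (ℕₚ.<⇒≤ I<J) X)

  neighbourColour : ℕ → ℕ → Bool
  neighbourColour J x = (x ≡ᵇ J) ∨ ((x <ᵇ J) ∧ (L x J ≡ᵇ 1))

  neighbourColour-inner : ∀ {J} → J < n → ∀ b → neighbourColour J (if b then J else dead) ≡ b
  neighbourColour-inner {J} J<n true  rewrite ≡ᵇ-true {J} refl = refl
  neighbourColour-inner {J} J<n false rewrite ≡ᵇ-false (ℕₚ.>⇒≢ J<n) | <ᵇ-false (ℕₚ.<⇒≤ J<n) = refl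

  stageColour-suc-branch : ∀ {J l} → J < n → l < suc J →
                           stageColour (suc J) (branch l) ≡ (stageColour J [ J ↦ dead ] [ live ↦ J ]) (branch l)
  stageColour-suc-branch {J} {l} J<n l<1+J rewrite ≡ᵇ-false (ℕₚ.<⇒≢ l<1+J) with l ≟ℕ J
  ... | yes refl rewrite ≡ᵇ-true {l} refl | ≡ᵇ-false (ℕₚ.>⇒≢ (ℕₚ.m<n⇒m<1+n J<n)) | ≡ᵇ-true {live} refl = refl
  ... | no l≢J
    rewrite ≡ᵇ-false l≢J | ≡ᵇ-false l≢J | ≡ᵇ-false (ℕₚ.<⇒≢ (ℕₚ.<-≤-trans l<1+J (s≤s (ℕₚ.<⇒≤ J<n)))) = refl

  stageColour-suc-inner : ∀ {J i j t} → J < n → j < suc J →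
                          stageColour (suc J) (inner i j t) ≡ (stageColour J [ J ↦ dead ] [ live ↦ J ]) (inner i j t)
  stageColour-suc-inner {J} {i} {j} {t} J<n j<1+J rewrite ≡ᵇ-false (ℕₚ.<⇒≢ j<1+J) with (j ≡ᵇ J) ∧ (suc t ≡ᵇ L i j)
  ... | true  rewrite ≡ᵇ-true {J} refl | ≡ᵇ-false (ℕₚ.1+n≢n {n} ∘ sym) = refl
  ... | false rewrite ≡ᵇ-false (ℕₚ.>⇒≢ J<n) | ≡ᵇ-false (ℕₚ.1+n≢n {n} ∘ sym) = refl

  module BranchAttachment {J : ℕ} (J<n : J < n) where

    new : Site
    new = branch J

    J<live : J < live
    J<live = ℕₚ.m<n⇒m<1+n J<n

    live∉C : neighbourColour J live ≡ false
    live∉C rewrite ≡ᵇ-false (ℕₚ.>⇒≢ J<live) | <ᵇ-false (ℕₚ.<⇒≤ J<live) = refl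

    new-colour : stageColour J new ≡ live
    new-colour rewrite ≡ᵇ-true {J} refl = refl

    disjoint : Disjoint (Stage J J) ⁅ new ⁆
    disjoint u∈ u∈new with ∈⁅⁆⁻ u∈new
    ... | refl = ℕₚ.<-irrefl refl (toWitness (holds u∈))

    new∉C : ∀ {v} → v ∈ ⁅ new ⁆ → neighbourColour J (stageColour J v) ≡ false
    new∉C v∈ rewrite ∈⁅⁆⁻ v∈ | new-colour = live∉C

    edge : ∀ u → u ∈ Stage J J → E subdivision u new ≡ neighbourColour J (stageColour J u)
    edge (branch l) (member h)
      rewrite ≡ᵇ-false (ℕₚ.<⇒≢ (toWitness h)) | <ᵇ-true (toWitness h) | <ᵇ-false {J} {l} (ℕₚ.<⇒≤ (toWitness h))
            | ≡ᵇ-false (ℕₚ.<⇒≢ (toWitness h)) = ∨-identityʳ _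
    edge (inner i j t) (member h) with toWitness h
    ... | (i<j , _) , j<J⊎j≡J rewrite ≡ᵇ-false {J} {i} (ℕₚ.>⇒≢ ([ ℕₚ.<-trans i<j , proj₂ ] j<J⊎j≡J)) =
      trans (∨-identityʳ _) (sym (neighbourColour-inner J<n ((j ≡ᵇ J) ∧ (suc t ≡ᵇ L i j))))

    across : ∀ {u v} → u ∈ Stage J J → v ∈ ⁅ new ⁆ →
             E subdivision u v ≡ (neighbourColour J (stageColour J u) ∧ (stageColour J v ≡ᵇ live))
    across {u} u∈ v∈ rewrite ∈⁅⁆⁻ v∈ | new-colour | ≡ᵇ-true {live} refl = trans (edge u u∈) (sym (∧-identityʳ _))

    grow : Stage J J ∪ ⁅ new ⁆ ⊆ Stage (suc J) 0
    grow v∈ with ∈-∪⁻ {S₁ = Stage J J} v∈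
    ... | inj₂ v∈new rewrite ∈⁅⁆⁻ v∈new = member (fromWitness (ℕₚ.n<1+n J))
    grow {branch l} _ | inj₁ (member h) = member (fromWitness (ℕₚ.m<n⇒m<1+n (toWitness h)))
    grow {inner i j t} _ | inj₁ (member h) with toWitness h
    ... | valid , inj₁ j<J        = inner∈stage valid (inj₁ (ℕₚ.m<n⇒m<1+n j<J))
    ... | valid , inj₂ (refl , _) = inner∈stage valid (inj₁ (ℕₚ.n<1+n J))

    shrink : Stage (suc J) 0 ⊆ Stage J J ∪ ⁅ new ⁆
    shrink {branch l} (member h) with ℕₚ.m<1+n⇒m<n∨m≡n (toWitness h)
    ... | inj₁ l<J  = ∈-∪ˡ {S₂ = ⁅ new ⁆} (member (fromWitness l<J))
    ... | inj₂ refl = ∈-∪ʳ {S₁ = Stage J J} (∈⁅⁆ new)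
    shrink {inner i j t} (member h) with toWitness h
    ... | valid , inj₁ j<1+J with ℕₚ.m<1+n⇒m<n∨m≡n j<1+J
    ...   | inj₁ j<J  = ∈-∪ˡ {S₂ = ⁅ new ⁆} (inner∈stage valid (inj₁ j<J))
    ...   | inj₂ refl = ∈-∪ˡ {S₂ = ⁅ new ⁆} (inner∈stage valid (inj₂ (refl , proj₁ valid)))

    recoloured : ∀ {v} → v ∈ Stage J J ∪ ⁅ new ⁆ → stageColour (suc J) v ≡ (stageColour J [ J ↦ dead ] [ live ↦ J ]) v
    recoloured v∈ with grow v∈
    recoloured {branch l}    _ | member h = stageColour-suc-branch J<n (toWitness h)
    recoloured {inner i j t} _ | member h with toWitness h
    ... | _ , inj₁ j<1+J = stageColour-suc-inner J<n j<1+J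

  stage-branch : ∀ {J} → 1 ≤ J → J < n → Expressible k subdivision (Stage J J) (stageColour J) →
                 Expressible k subdivision (Stage (suc J) 0) (stageColour (suc J))
  stage-branch {J} 1≤J J<n X =
    Expressible-cong (Expressible-recolour live<k J<k (Expressible-recolour J<k dead<k attached))
      grow shrink (λ _ _ → refl) recoloured
    where
      open BranchAttachment J<n
      J<k = colour<k (ℕₚ.<⇒≤ J<live)
      attached : Expressible k subdivision (Stage J J ∪ ⁅ new ⁆) (stageColour J)
      attached = Expressible-attach live (neighbourColour J) live<k live∉C X
        (Expressible-singleton new (∈⁅⁆ new) ∈⁅⁆⁻ (subst (_< k) (sym new-colour) live<k))
        (branch 0 , member (fromWitness 1≤J)) (new , ∈⁅⁆ new) disjoint (stageColour-≢live J<n) new∉C across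

  stage-one : Expressible k subdivision (Stage 1 0) (stageColour 1)
  stage-one = Expressible-singleton (branch 0) (member (fromWitness {a? = 0 <? 1} (s≤s z≤n))) only 0<k
    where
      only : ∀ {u} → u ∈ Stage 1 0 → u ≡ branch 0
      only {branch l} (member h) with toWitness h
      ... | s≤s z≤n = refl
      only {inner i j t} (member h) with toWitness h
      ... | (() , _) , inj₁ (s≤s z≤n)

  stages : ∀ J → 1 ≤ J → J ≤ n → Expressible k subdivision (Stage J 0) (stageColour J)
  stages 1             _ _     = stage-one
  stages (suc (suc J)) _ 2+J≤n =
    stage-branch (s≤s z≤n) 2+J≤n (stage-paths 2+J≤n (suc J) ℕₚ.≤-refl (stages (suc J) (s≤s z≤n) (ℕₚ.<⇒≤ 2+J≤n)))

  subdivision-expressible : Expressible k subdivision Valid (stageColour n)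
  subdivision-expressible = Expressible-cong (stages n (ℕₚ.<⇒≤ 2≤n) ℕₚ.≤-refl) to from (λ _ _ → refl) (λ _ → refl)
    where
      to : Stage n 0 ⊆ Valid
      to {branch l}    (member h) = member h
      to {inner i j t} (member h) = member (fromWitness (proj₁ (toWitness h)))
      from : Valid ⊆ Stage n 0
      from {branch l}    (member h) = member h
      from {inner i j t} (member h) with toWitness h
      ... | valid@(_ , j<n , _) = inner∈stage valid (inj₁ j<n)

-- Embedding the standard subdivision into a subdivision of K_n

module _ {d : ℕ} .{{_ : NonZero d}} where

  toℕ-mod : ∀ {a} → a < d → toℕ (a mod d) ≡ a
  toℕ-mod {a} a<d = trans (toℕ-fromℕ< _) (m<n⇒m%n≡m a<d)

  mod-toℕ : ∀ (x : Fin d) → toℕ x mod d ≡ x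
  mod-toℕ x = toℕ-injective (toℕ-mod (toℕ<n x))

  mod-injective : ∀ {a b} → a < d → b < d → a mod d ≡ b mod d → a ≡ b
  mod-injective a<d b<d e = trans (sym (toℕ-mod a<d)) (trans (cong toℕ e) (toℕ-mod b<d))

module Embedding {n m} .{{_ : NonZero n}} {G : Graph m} (sub : SubdivisionOfK n G) where
  private
    module S = SubdivisionOfK sub

  index : ℕ → Fin n
  index i = i mod n

  L : ℕ → ℕ → ℕ
  L i j = S.len (index i) (index j)

  open StandardSubdivision n L

  φ : Site → Fin m
  φ (branch l)    = S.branch (index l)
  φ (inner i j t) = S.path (index i) (index j) (t mod suc (L i j))

  L-toℕ : ∀ fi fj → L (toℕ fi) (toℕ fj) ≡ S.len fi fj
  L-toℕ fi fj = cong₂ S.len (mod-toℕ fi) (mod-toℕ fj)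

  toℕ<L : ∀ {fi fj} (t : Fin (S.len fi fj)) → toℕ t < L (toℕ fi) (toℕ fj)
  toℕ<L {fi} {fj} t = subst (toℕ t <_) (sym (L-toℕ fi fj)) (toℕ<n t)

  index-< : ∀ {i j} → i < j → j < n → index i Fin.< index j
  index-< i<j j<n = subst₂ _<_ (sym (toℕ-mod (ℕₚ.<-trans i<j j<n))) (sym (toℕ-mod j<n)) i<j

  path-reindex : ∀ {a b fi fj} (t : Fin (suc (S.len fi fj))) → a ≡ fi → b ≡ fj →
                 S.path a b (toℕ t mod suc (S.len a b)) ≡ S.path fi fj t
  path-reindex t refl refl = cong (S.path _ _) (mod-toℕ t)

  φ-onPath : ∀ {fi fj} → fi Fin.< fj → (t : Fin (suc (S.len fi fj))) →
             φ (onPath (toℕ fi) (toℕ fj) (toℕ t)) ≡ S.path fi fj t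
  φ-onPath {fi} {fj} fi<fj zero = trans (cong S.branch (mod-toℕ fi)) (sym (S.path-start fi fj fi<fj))
  φ-onPath {fi} {fj} fi<fj (suc t) with suc (toℕ t) ≟ℕ L (toℕ fi) (toℕ fj)
  ... | yes 1+t≡L rewrite onPath-last {toℕ fi} {toℕ fj} 1+t≡L =
    trans (cong S.branch (mod-toℕ fj)) (trans (sym (S.path-end fi fj fi<fj)) (cong (S.path fi fj) (sym last)))
    where
      last : suc t ≡ Fin.fromℕ (S.len fi fj)
      last = toℕ-injective (trans 1+t≡L (trans (L-toℕ fi fj) (sym (toℕ-fromℕ _))))
  ... | no 1+t≢L rewrite onPath-inner {toℕ fi} {toℕ fj} {suc (toℕ t)} (s≤s z≤n)
                           (ℕₚ.≤∧≢⇒< (toℕ<L t) 1+t≢L) =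
    path-reindex (suc t) (mod-toℕ fi) (mod-toℕ fj)

  φ-onPathℕ : ∀ {i j} → i < j → j < n → (t : Fin (suc (L i j))) →
              φ (onPath i j (toℕ t)) ≡ S.path (index i) (index j) t
  φ-onPathℕ {i} {j} i<j j<n t =
    trans (cong₂ (λ a b → φ (onPath a b (toℕ t))) (sym (toℕ-mod (ℕₚ.<-trans i<j j<n))) (sym (toℕ-mod j<n)))
          (φ-onPath (index-< i<j j<n) t)

  internal : ∀ {i j t} → ValidInner i j t → Internal {L i j} (t mod suc (L i j))
  internal (_ , _ , 0<t , t<L) = subst (0 <_) (sym (toℕ-mod (ℕₚ.m<n⇒m<1+n t<L))) 0<t ,
                                 subst (_< _) (sym (toℕ-mod (ℕₚ.m<n⇒m<1+n t<L))) t<L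

  φ-injective : ∀ {u v} → u ∈ Valid → v ∈ Valid → φ u ≡ φ v → u ≡ v
  φ-injective {branch l} {branch l′} (member u∈) (member v∈) e =
    cong branch (mod-injective (toWitness u∈) (toWitness v∈) (S.branch-inj e))
  φ-injective {branch l} {inner i j t} _ (member v∈) e with toWitness v∈
  ... | valid@(i<j , j<n , _) = ⊥-elim (S.internal-new _ _ (index-< i<j j<n) _ (internal valid) (index l) (sym e))
  φ-injective {inner i j t} {branch l} (member u∈) _ e with toWitness u∈
  ... | valid@(i<j , j<n , _) = ⊥-elim (S.internal-new _ _ (index-< i<j j<n) _ (internal valid) (index l) e)
  φ-injective {inner i j t} {inner i′ j′ t′} (member u∈) (member v∈) e with toWitness u∈ | toWitness v∈
  ... | valid@(i<j , j<n , _ , t<L) | valid′@(i′<j′ , j′<n , _ , t′<L′)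
    with S.internal-disj _ _ _ _ (index-< i<j j<n) (index-< i′<j′ j′<n) _ _ (internal valid) (internal valid′) e
  ... | ei , ej with mod-injective (ℕₚ.<-trans i<j j<n) (ℕₚ.<-trans i′<j′ j′<n) ei | mod-injective j<n j′<n ej
  ...   | refl | refl =
    cong (inner i j) (mod-injective (ℕₚ.m<n⇒m<1+n t<L) (ℕₚ.m<n⇒m<1+n t′<L′) (S.path-inj _ _ (index-< i<j j<n) e))

  φ-onto : ∀ w → ∃[ v ] v ∈ Valid × φ v ≡ w
  φ-onto w with S.covers w
  ... | inj₁ (l , e) = branch (toℕ l) , member (fromWitness (toℕ<n l)) , trans (cong S.branch (mod-toℕ l)) e
  ... | inj₂ (fi , fj , fi<fj , t , (0<t , t<len) , e) =
    inner (toℕ fi) (toℕ fj) (toℕ t) ,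
    member (fromWitness (fi<fj , toℕ<n fj , 0<t , subst (toℕ t <_) (sym (L-toℕ fi fj)) t<len)) ,
    trans (path-reindex t (mod-toℕ fi) (mod-toℕ fj)) e

  Step⇒adj : ∀ {u v} → Step u v → adj G (φ u) (φ v) ≡ true
  Step⇒adj (step {i} {j} {t} i<j j<n t<L) =
    proj₂ (S.edges _ _) (index i , index j , index-< i<j j<n , fromℕ< t<L , inj₁ (sym e₁ , sym e₂))
    where
      e₁ : φ (onPath i j t) ≡ S.path (index i) (index j) (Fin.inject₁ (fromℕ< t<L))
      e₁ = trans (cong (φ ∘ onPath i j) (sym (trans (toℕ-inject₁ _) (toℕ-fromℕ< t<L)))) (φ-onPathℕ i<j j<n _)
      e₂ : φ (onPath i j (suc t)) ≡ S.path (index i) (index j) (suc (fromℕ< t<L))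
      e₂ = trans (cong (φ ∘ onPath i j ∘ suc) (sym (toℕ-fromℕ< t<L))) (φ-onPathℕ i<j j<n _)

  path⇒next : ∀ {u v fi fj} → fi Fin.< fj → (t : Fin (S.len fi fj)) → u ∈ Valid → v ∈ Valid →
             S.path fi fj (Fin.inject₁ t) ≡ φ u → S.path fi fj (suc t) ≡ φ v → T (next u v)
  path⇒next {u} {v} {fi} {fj} fi<fj t u∈ v∈ e₁ e₂ =
    Step⇒next (subst₂ Step (sym u≡) (sym v≡) (step fi<fj (toℕ<n fj) (toℕ<L t)))
    where
      u≡ : u ≡ onPath (toℕ fi) (toℕ fj) (toℕ t)
      u≡ = φ-injective u∈ (onPath-valid fi<fj (toℕ<n fj) (ℕₚ.<⇒≤ (toℕ<L t)))
             (trans (sym e₁) (sym (trans (cong (φ ∘ onPath (toℕ fi) (toℕ fj)) (sym (toℕ-inject₁ t)))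
                                         (φ-onPath fi<fj _))))
      v≡ : v ≡ onPath (toℕ fi) (toℕ fj) (suc (toℕ t))
      v≡ = φ-injective v∈ (onPath-valid fi<fj (toℕ<n fj) (toℕ<L t)) (trans (sym e₂) (sym (φ-onPath fi<fj (suc t))))

  φ-adj : ∀ {u v} → u ∈ Valid → v ∈ Valid → adj G (φ u) (φ v) ≡ E subdivision u v
  φ-adj {u} {v} u∈ v∈ = T-ext to from
    where
      to : T (adj G (φ u) (φ v)) → T (next u v ∨ next v u)
      to a with proj₁ (S.edges (φ u) (φ v)) (Equivalence.to T-≡ a)
      ... | _ , _ , fi<fj , t , inj₁ (e₁ , e₂) = Equivalence.from T-∨ (inj₁ (path⇒next fi<fj t u∈ v∈ e₁ e₂))
      ... | _ , _ , fi<fj , t , inj₂ (e₁ , e₂) =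
        Equivalence.from (T-∨ {next u v}) (inj₂ (path⇒next fi<fj t v∈ u∈ e₁ e₂))
      from : T (next u v ∨ next v u) → T (adj G (φ u) (φ v))
      from h with Equivalence.to (T-∨ {next u v}) h
      ... | inj₁ uv = Equivalence.from T-≡ (Step⇒adj (next⇒Step u∈ v∈ uv))
      ... | inj₂ vu = Equivalence.from T-≡ (trans (Graph.sym G _ _) (Step⇒adj (next⇒Step v∈ u∈ vu)))

lemma11 : (n : ℕ) → 4 ≤ n → {m : ℕ} (G : Graph m) →
          SubdivisionOfK n G → CliquewidthAtMost G (n + 2)
lemma11 zero () G sub
lemma11 n@(suc _) 4≤n G sub =
  subst (CliquewidthAtMost G) (ℕₚ.+-comm 2 n)
    (Expressible⇒CliquewidthAtMost subdivision-expressible φ φ-injective φ-onto φ-adj)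
  where
    open Embedding sub
    open Construction n L (ℕₚ.≤-trans (s≤s (s≤s z≤n)) 4≤n)
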